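{- Let $K=\mathbb{Q}(\alpha)$, where $\alpha>1$ is a real quadratic irrational which is a unit in the ring of integers of $K$. Let $(r(n))_n$ be a sequence of even positive integers with $r(n)\to\infty$ as $n\to\infty$, and set $A_n=\alpha^{r(n)}+\alpha^{2r(n)}$. Then for all sufficiently large $n$ the period length $\ell(A_n)$ of the continued fraction of $A_n$ equals $4$; in particular $(\ell(A_n))_n$ is bounded.
   Context: For a real quadratic irrational $\beta$, $\ell(\beta)$ denotes the length of the period of its simple continued fraction expansion. -}

module Defs where

open import Data.Nat as ℕ using (ℕ; zero; suc)
open import Data.Integer as ℤ using (ℤ; +_)
open import Data.Rational as ℚ using (ℚ; 0ℚ; 1ℚ; _/_)
open import Data.Product using (Σ; ∃; ∃-syntax; _×_; _,_)
open import Data.Sum using (_⊎_)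
open import Relation.Binary.PropositionalEquality using (_≡_; _≢_)

-- ℚ(√D): the element  re + im·√D  (D a positive non-square natural number,
-- √D the positive real square root).  ℚ is normalised, so ≡ is the right equality.
record Q√ : Set where
  constructor _+√_
  field
    re : ℚ
    im : ℚ
open Q√ public

NonSquare : ℕ → Set
NonSquare D = ∀ (m : ℕ) → m ℕ.* m ≢ D

ofℤ : ℤ → ℚ
ofℤ z = z / 1

embℤ : ℤ → Q√
embℤ z = ofℤ z +√ 0ℚ

zeroQ oneQ : Q√
zeroQ = 0ℚ +√ 0ℚ
oneQ  = 1ℚ +√ 0ℚ

infixl 6 _⊕_ _⊖_
infix 8 ⊝_
_⊕_ : Q√ → Q√ → Q√
(a +√ b) ⊕ (c +√ d) = (a ℚ.+ c) +√ (b ℚ.+ d)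

⊝_ : Q√ → Q√
⊝ (a +√ b) = (ℚ.- a) +√ (ℚ.- b)

_⊖_ : Q√ → Q√ → Q√
x ⊖ y = x ⊕ (⊝ y)

mul : ℕ → Q√ → Q√ → Q√
mul D (a +√ b) (c +√ d) =
  (a ℚ.* c ℚ.+ b ℚ.* d ℚ.* ofℤ (+ D)) +√ (a ℚ.* d ℚ.+ b ℚ.* c)

pow : ℕ → Q√ → ℕ → Q√
pow D x zero    = oneQ
pow D x (suc n) = mul D x (pow D x n)

-- a + b√D ≥ 0 as a real number (√D > 0), decided by comparing squares.
NonNeg : ℕ → Q√ → Set
NonNeg D (a +√ b) =
    (0ℚ ℚ.≤ a × 0ℚ ℚ.≤ b)
  ⊎ (0ℚ ℚ.≤ a × b ℚ.< 0ℚ × b ℚ.* b ℚ.* ofℤ (+ D) ℚ.≤ a ℚ.* a)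
  ⊎ (a ℚ.< 0ℚ × 0ℚ ℚ.< b × a ℚ.* a ℚ.≤ b ℚ.* b ℚ.* ofℤ (+ D))

LeQ : ℕ → Q√ → Q√ → Set
LeQ D x y = NonNeg D (y ⊖ x)

LtQ : ℕ → Q√ → Q√ → Set
LtQ D x y = LeQ D x y × x ≢ y

IsFloor : ℕ → ℤ → Q√ → Set
IsFloor D m x = LeQ D (embℤ m) x × LtQ D x (embℤ (m ℤ.+ + 1))

-- algebraic integer of ℚ(√D): root of a monic integer polynomial X² + c₁X + c₀
-- (in a quadratic field every algebraic integer is a root of such a polynomial)
IsAlgInt : ℕ → Q√ → Set
IsAlgInt D x = ∃[ c₁ ] ∃[ c₀ ]
  (mul D x x ⊕ mul D (embℤ c₁) x ⊕ embℤ c₀) ≡ zeroQ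

IsUnitOfIntegers : ℕ → Q√ → Set
IsUnitOfIntegers D x = IsAlgInt D x × ∃[ y ] (IsAlgInt D y × mul D x y ≡ oneQ)

record CFExpansion (D : ℕ) (x : Q√) : Set where
  field
    xs    : ℕ → Q√
    as    : ℕ → ℤ
    start : xs 0 ≡ x
    floor : ∀ k → IsFloor D (as k) (xs k)
    step  : ∀ k → mul D (xs (suc k)) (xs k ⊖ embℤ (as k)) ≡ oneQ
open CFExpansion public

EventuallyPeriodic : (ℕ → ℤ) → ℕ → Set
EventuallyPeriodic a p = ∃[ k₀ ] ∀ k → k₀ ℕ.≤ k → a (k ℕ.+ p) ≡ a k

LeastPeriod : (ℕ → ℤ) → ℕ → Set
LeastPeriod a p = 0 ℕ.< p × EventuallyPeriodic a p
  × (∀ q → 0 ℕ.< q → EventuallyPeriodic a q → p ℕ.≤ q)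

-- ℓ(x) = p  (the expansion is unique, so "some expansion" = "the expansion")
PeriodLength : ℕ → Q√ → ℕ → Set
PeriodLength D x p = Σ (CFExpansion D x) λ e → LeastPeriod (as e) p

TendsToInfinity : (ℕ → ℕ) → Set
TendsToInfinity r = ∀ M → ∃[ N ] ∀ n → N ℕ.≤ n → M ℕ.≤ r n

-- For even r = 2m, ε = α^r = (α²)^m is a unit of norm 1 with positive coordinates, and its trace t
-- is the m-th term of the Lucas sequence V(τ, 1), τ = Tr α² ≥ 3 (both facts use α > 1), so
-- t ≥ m + 2 ≥ 5 once r ≥ 6.  From ε² = tε − 1 we get ε + ε² = θ − 1 with θ = (t + 1)ε, a root of
-- X² − sX + n for s = t(t + 1), n = (t + 1)².  The complete quotients of θ − 1 are (P + θ)/Q for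
-- (P, Q) = (−1, 1), (−2, t² − 5), (−t − 3, t + 2), (−t − 3, t² − 5), (−2, 1), after which the second
-- pair recurs; each transition is checked through P + P' + s = mQ, N(P' + θ) = −QQ' and one
-- inequality.  So the partial quotients are t² + t − 3; 1, t − 3, 1, t² + t − 4, … with least period 4.

module Submission where

open import Defs
open import Data.Empty using (⊥-elim)
open import Data.Integer as ℤ using (ℤ; +_; -[1+_]; 1ℤ; -1ℤ)
import Data.Integer.Properties as ℤP
open import Data.Integer.Tactic.RingSolver using () renaming (ring to ℤ-ring)
open import Data.List using (List; []; _∷_)
open import Data.Maybe using (just; nothing)
open import Data.Nat as ℕ using (ℕ; zero; suc)
open import Data.Nat.Coprimality as Coprimality using (Coprime; coprime-divisor)
open import Data.Nat.Divisibility using (_∣_; divides; ∣-refl)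
import Data.Nat.Properties as ℕP
open import Data.Product using (∃-syntax; _×_; _,_; proj₁; proj₂; map₂)
open import Data.Rational as ℚ using (ℚ; mkℚ; 0ℚ; 1ℚ; _+_; _*_; -_; _-_; _≤_; _<_)
import Data.Rational.Properties as ℚP
import Data.Rational.Unnormalised as ℚᵘ
import Data.Rational.Unnormalised.Properties as ℚᵘP
open import Data.Sum using (_⊎_; inj₁; inj₂)
open import Function using (_∘_)
open import Level using (0ℓ)
open import Relation.Binary.PropositionalEquality
open import Relation.Nullary using (¬_; yes; no)
open import Tactic.RingSolver using (solve-∀)
import Tactic.RingSolver.Core.AlmostCommutativeRing as ACR

ℚ-ring : ACR.AlmostCommutativeRing 0ℓ 0ℓ
ℚ-ring = ACR.fromCommutativeRing ℚP.+-*-commutativeRing is-zero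
  where
  is-zero : ∀ x → _
  is-zero x with 0ℚ ℚ.≟ x
  ... | yes 0≡x = just 0≡x
  ... | no  _   = nothing

toℚᵘ-ofℤ : ∀ z → ℚ.toℚᵘ (ofℤ z) ℚᵘ.≃ ℚᵘ.mkℚᵘ z 0
toℚᵘ-ofℤ z = ℚP.toℚᵘ-fromℚᵘ (ℚᵘ.mkℚᵘ z 0)

ofℤ-+ : ∀ x y → ofℤ (x ℤ.+ y) ≡ ofℤ x + ofℤ y
ofℤ-+ x y = ℚP.toℚᵘ-injective (begin
  ℚ.toℚᵘ (ofℤ (x ℤ.+ y))                      ≈⟨ toℚᵘ-ofℤ (x ℤ.+ y) ⟩
  ℚᵘ.mkℚᵘ (x ℤ.+ y) 0                         ≈⟨ ℚᵘ.*≡* (sum-cross x y) ⟩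
  ℚᵘ.mkℚᵘ x 0 ℚᵘ.+ ℚᵘ.mkℚᵘ y 0                ≈⟨ ℚᵘP.+-cong (toℚᵘ-ofℤ x) (toℚᵘ-ofℤ y) ⟨
  ℚ.toℚᵘ (ofℤ x) ℚᵘ.+ ℚ.toℚᵘ (ofℤ y)          ≈⟨ ℚP.toℚᵘ-homo-+ (ofℤ x) (ofℤ y) ⟨
  ℚ.toℚᵘ (ofℤ x + ofℤ y)                      ∎)
  where
  open ℚᵘP.≃-Reasoning
  sum-cross : ∀ x y → (x ℤ.+ y) ℤ.* + 1 ≡ (x ℤ.* + 1 ℤ.+ y ℤ.* + 1) ℤ.* + 1
  sum-cross = solve-∀ ℤ-ring

ofℤ-* : ∀ x y → ofℤ (x ℤ.* y) ≡ ofℤ x * ofℤ y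
ofℤ-* x y = ℚP.toℚᵘ-injective (begin
  ℚ.toℚᵘ (ofℤ (x ℤ.* y))                      ≈⟨ toℚᵘ-ofℤ (x ℤ.* y) ⟩
  ℚᵘ.mkℚᵘ x 0 ℚᵘ.* ℚᵘ.mkℚᵘ y 0                ≈⟨ ℚᵘP.*-cong (toℚᵘ-ofℤ x) (toℚᵘ-ofℤ y) ⟨
  ℚ.toℚᵘ (ofℤ x) ℚᵘ.* ℚ.toℚᵘ (ofℤ y)          ≈⟨ ℚP.toℚᵘ-homo-* (ofℤ x) (ofℤ y) ⟨
  ℚ.toℚᵘ (ofℤ x * ofℤ y)                      ∎)
  where open ℚᵘP.≃-Reasoning

ofℤ-neg : ∀ x → ofℤ (ℤ.- x) ≡ - ofℤ x
ofℤ-neg x = ℚP.toℚᵘ-injective (begin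
  ℚ.toℚᵘ (ofℤ (ℤ.- x))      ≈⟨ toℚᵘ-ofℤ (ℤ.- x) ⟩
  ℚᵘ.- ℚᵘ.mkℚᵘ x 0          ≈⟨ ℚᵘP.-‿cong (toℚᵘ-ofℤ x) ⟨
  ℚᵘ.- ℚ.toℚᵘ (ofℤ x)       ≈⟨ ℚP.toℚᵘ-homo‿- (ofℤ x) ⟨
  ℚ.toℚᵘ (- ofℤ x)          ∎)
  where open ℚᵘP.≃-Reasoning

ofℤ-- : ∀ x y → ofℤ (x ℤ.- y) ≡ ofℤ x - ofℤ y
ofℤ-- x y = trans (ofℤ-+ x (ℤ.- y)) (cong (λ z → ofℤ x + z) (ofℤ-neg y))

ofℤ-injective : ∀ {x y} → ofℤ x ≡ ofℤ y → x ≡ y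
ofℤ-injective {x} {y} eq
  with ℚᵘP.≃-trans (ℚᵘP.≃-sym (toℚᵘ-ofℤ x)) (ℚᵘP.≃-trans (ℚP.toℚᵘ-cong eq) (toℚᵘ-ofℤ y))
... | ℚᵘ.*≡* x*1≡y*1 = trans (sym (ℤP.*-identityʳ x)) (trans x*1≡y*1 (ℤP.*-identityʳ y))

ofℤ-mono-≤ : ∀ {x y} → x ℤ.≤ y → ofℤ x ≤ ofℤ y
ofℤ-mono-≤ {x} {y} x≤y = ℚP.toℚᵘ-cancel-≤
  (ℚᵘP.≤-respʳ-≃ (ℚᵘP.≃-sym (toℚᵘ-ofℤ y)) (ℚᵘP.≤-respˡ-≃ (ℚᵘP.≃-sym (toℚᵘ-ofℤ x))
    (ℚᵘ.*≤* (subst₂ ℤ._≤_ (sym (ℤP.*-identityʳ x)) (sym (ℤP.*-identityʳ y)) x≤y))))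

ofℤ-cancel-≤ : ∀ {x y} → ofℤ x ≤ ofℤ y → x ℤ.≤ y
ofℤ-cancel-≤ {x} {y} x≤y
  with ℚᵘP.≤-respʳ-≃ (toℚᵘ-ofℤ y) (ℚᵘP.≤-respˡ-≃ (toℚᵘ-ofℤ x) (ℚP.toℚᵘ-mono-≤ x≤y))
... | ℚᵘ.*≤* x*1≤y*1 = subst₂ ℤ._≤_ (ℤP.*-identityʳ x) (ℤP.*-identityʳ y) x*1≤y*1

*-pos : ∀ {x y} → 0ℚ < x → 0ℚ < y → 0ℚ < x * y
*-pos {x} {y} 0<x 0<y = ℚP.positive⁻¹ (x * y) {{ℚP.pos*pos⇒pos x {{ℚ.positive 0<x}} y {{ℚ.positive 0<y}}}}

*-nonNeg : ∀ {x y} → 0ℚ ≤ x → 0ℚ ≤ y → 0ℚ ≤ x * y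
*-nonNeg {x} {y} 0≤x 0≤y =
  ℚP.nonNegative⁻¹ (x * y) {{ℚP.nonNeg*nonNeg⇒nonNeg x {{ℚ.nonNegative 0≤x}} y {{ℚ.nonNegative 0≤y}}}}

*-pos-neg : ∀ {x y} → 0ℚ < x → y < 0ℚ → x * y < 0ℚ
*-pos-neg {x} {y} 0<x y<0 = ℚP.negative⁻¹ (x * y) {{ℚP.pos*neg⇒neg x {{ℚ.positive 0<x}} y {{ℚ.negative y<0}}}}

*-monoˡ-≤-nonNeg : ∀ {k x y} → 0ℚ ≤ k → x ≤ y → k * x ≤ k * y
*-monoˡ-≤-nonNeg {k} 0≤k = ℚP.*-monoˡ-≤-nonNeg k {{ℚ.nonNegative 0≤k}}

0≤y-x⇒x≤y : ∀ {x y} → 0ℚ ≤ y - x → x ≤ y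
0≤y-x⇒x≤y {x} {y} 0≤y-x = subst₂ _≤_ (ℚP.+-identityˡ x) (cancel x y) (ℚP.+-monoˡ-≤ x 0≤y-x)
  where
  cancel : ∀ x y → (y - x) + x ≡ y
  cancel = solve-∀ ℚ-ring

x-y≤0⇒x≤y : ∀ {x y} → x - y ≤ 0ℚ → x ≤ y
x-y≤0⇒x≤y {x} {y} x-y≤0 = subst₂ _≤_ (cancel x y) (ℚP.+-identityˡ y) (ℚP.+-monoˡ-≤ y x-y≤0)
  where
  cancel : ∀ x y → (x - y) + y ≡ x
  cancel = solve-∀ ℚ-ring

x*y≡0⇒y≡0 : ∀ {x y} → x ≢ 0ℚ → x * y ≡ 0ℚ → y ≡ 0ℚ
x*y≡0⇒y≡0 {x} {y} x≢0 xy≡0 = begin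
  y                   ≡⟨ sym (ℚP.*-identityˡ y) ⟩
  1ℚ * y              ≡⟨ cong (_* y) (sym (ℚP.*-inverseˡ x)) ⟩
  ℚ.1/ x * x * y      ≡⟨ ℚP.*-assoc (ℚ.1/ x) x y ⟩
  ℚ.1/ x * (x * y)    ≡⟨ cong (ℚ.1/ x *_) xy≡0 ⟩
  ℚ.1/ x * 0ℚ         ≡⟨ ℚP.*-zeroʳ (ℚ.1/ x) ⟩
  0ℚ                  ∎
  where
  open ≡-Reasoning
  instance
    _ : ℚ.NonZero x
    _ = ℚ.≢-nonZero x≢0

x≤y⇒0≤y-x : ∀ {x y} → x ≤ y → 0ℚ ≤ y - x
x≤y⇒0≤y-x {x} {y} x≤y = subst (_≤ y - x) (ℚP.+-inverseʳ x) (ℚP.+-monoˡ-≤ (- x) x≤y)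

0≤x+x⇒0≤x : ∀ {x} → 0ℚ ≤ x + x → 0ℚ ≤ x
0≤x+x⇒0≤x {x} 0≤2x = ℚP.*-cancelˡ-≤-pos (ofℤ (+ 2)) (subst (0ℚ ≤_) (double x) 0≤2x)
  where
  double : ∀ x → x + x ≡ ofℤ (+ 2) * x
  double = solve-∀ ℚ-ring

*-cancelˡ-≡-pos : ∀ {k x y} → 0ℚ < k → k * x ≡ k * y → x ≡ y
*-cancelˡ-≡-pos {k} 0<k kx≡ky = ℚP.≤-antisym
  (ℚP.*-cancelˡ-≤-pos k {{ℚ.positive 0<k}} (ℚP.≤-reflexive kx≡ky))
  (ℚP.*-cancelˡ-≤-pos k {{ℚ.positive 0<k}} (ℚP.≤-reflexive (sym kx≡ky)))

≤-by-slack : ∀ {x y s} → + 0 ℤ.≤ s → y ≡ x ℤ.+ s → x ℤ.≤ y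
≤-by-slack {x} {s = s} 0≤s refl = ℤP.i≤i+j x s {{ℤ.nonNegative 0≤s}}

-- c₀ + κ (c₁ + κ (c₂ + ⋯)) with natural coefficients; inequalities in t = 5 + κ are proved by
-- writing their slack in this form.
horner : List ℕ → ℤ → ℤ
horner []               κ = + 0
horner (c ∷ [])         κ = + c
horner (c ∷ cs@(_ ∷ _)) κ = + c ℤ.+ κ ℤ.* horner cs κ

horner-nonNeg : ∀ cs k → + 0 ℤ.≤ horner cs (+ k)
horner-nonNeg []               k = ℤP.≤-refl
horner-nonNeg (c ∷ [])         k = ℤ.+≤+ ℕ.z≤n
horner-nonNeg (c ∷ cs@(_ ∷ _)) k = ℤP.+-mono-≤ (ℤ.+≤+ ℕ.z≤n) (k*-nonNeg (horner-nonNeg cs k))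
  where
  k*-nonNeg : ∀ {i} → + 0 ℤ.≤ i → + 0 ℤ.≤ + k ℤ.* i
  k*-nonNeg {+ n} _ = subst (+ 0 ℤ.≤_) (ℤP.pos-* k n) (ℤ.+≤+ ℕ.z≤n)

≤-by-horner : ∀ {x y} cs k → y ≡ x ℤ.+ horner cs (+ k) → x ℤ.≤ y
≤-by-horner cs k = ≤-by-slack (horner-nonNeg cs k)

i*j≡1⇒i≡±1 : ∀ i j → i ℤ.* j ≡ 1ℤ → i ≡ 1ℤ ⊎ i ≡ -1ℤ
i*j≡1⇒i≡±1 i j ij≡1 =
  sign-cases i (ℕP.m*n≡1⇒m≡1 ℤ.∣ i ∣ ℤ.∣ j ∣ (trans (sym (ℤP.abs-* i j)) (cong ℤ.∣_∣ ij≡1)))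
  where
  sign-cases : ∀ i → ℤ.∣ i ∣ ≡ 1 → i ≡ 1ℤ ⊎ i ≡ -1ℤ
  sign-cases (+ _)      refl = inj₁ refl
  sign-cases -[1+ zero ] _   = inj₂ refl

≡±1⇒square≡1 : ∀ {c} → c ≡ 1ℤ ⊎ c ≡ -1ℤ → c ℤ.* c ≡ 1ℤ
≡±1⇒square≡1 (inj₁ refl) = refl
≡±1⇒square≡1 (inj₂ refl) = refl

-- The field ℚ(√D)

module QuadraticField (D : ℕ) where

  d : ℚ
  d = ofℤ (+ D)

  0≤d : 0ℚ ≤ d
  0≤d = ofℤ-mono-≤ {+ 0} {+ D} (ℤ.+≤+ ℕ.z≤n)

  mul-comm : ∀ x y → mul D x y ≡ mul D y x
  mul-comm (a +√ b) (c +√ e) = cong₂ _+√_ (re-comm a b c e d) (im-comm a b c e)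
    where
    re-comm : ∀ a b c e d → a * c + b * e * d ≡ c * a + e * b * d
    re-comm = solve-∀ ℚ-ring
    im-comm : ∀ a b c e → a * e + b * c ≡ c * b + e * a
    im-comm = solve-∀ ℚ-ring

  mul-assoc : ∀ x y z → mul D (mul D x y) z ≡ mul D x (mul D y z)
  mul-assoc (a +√ b) (c +√ e) (f +√ g) = cong₂ _+√_ (re-assoc a b c e f g d) (im-assoc a b c e f g d)
    where
    re-assoc : ∀ a b c e f g d → (a * c + b * e * d) * f + (a * e + b * c) * g * d
                               ≡ a * (c * f + e * g * d) + b * (c * g + e * f) * d
    re-assoc = solve-∀ ℚ-ring
    im-assoc : ∀ a b c e f g d → (a * c + b * e * d) * g + (a * e + b * c) * f
                               ≡ a * (c * g + e * f) + b * (c * f + e * g * d)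
    im-assoc = solve-∀ ℚ-ring

  mul-identityʳ : ∀ x → mul D x oneQ ≡ x
  mul-identityʳ (a +√ b) = cong₂ _+√_ (re-id a b d) (im-id a b)
    where
    re-id : ∀ a b d → a * 1ℚ + b * 0ℚ * d ≡ a
    re-id = solve-∀ ℚ-ring
    im-id : ∀ a b → a * 0ℚ + b * 1ℚ ≡ b
    im-id = solve-∀ ℚ-ring

  pow-+ : ∀ x m n → pow D x (m ℕ.+ n) ≡ mul D (pow D x m) (pow D x n)
  pow-+ x zero    n = sym (trans (mul-comm oneQ (pow D x n)) (mul-identityʳ (pow D x n)))
  pow-+ x (suc m) n = trans (cong (mul D x) (pow-+ x m n)) (sym (mul-assoc x (pow D x m) (pow D x n)))

  pow-*2 : ∀ x k → pow D x (k ℕ.* 2) ≡ pow D (mul D x x) k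
  pow-*2 x zero    = refl
  pow-*2 x (suc k) = trans (sym (mul-assoc x x (pow D x (k ℕ.* 2)))) (cong (mul D (mul D x x)) (pow-*2 x k))

  pow-double : ∀ x n → pow D x (2 ℕ.* n) ≡ mul D (pow D x n) (pow D x n)
  pow-double x n = trans (pow-+ x n (n ℕ.+ 0)) (cong (λ m → mul D (pow D x n) (pow D x m)) (ℕP.+-identityʳ n))

  norm : Q√ → ℚ
  norm (a +√ b) = a * a - b * b * d

  norm-mul : ∀ x y → norm (mul D x y) ≡ norm x * norm y
  norm-mul (a +√ b) (c +√ e) = brahmagupta a b c e d
    where
    brahmagupta : ∀ a b c e d
      → (a * c + b * e * d) * (a * c + b * e * d) - (a * e + b * c) * (a * e + b * c) * d
      ≡ (a * a - b * b * d) * (c * c - e * e * d)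
    brahmagupta = solve-∀ ℚ-ring

  scale : ℚ → Q√ → Q√
  scale w (a +√ b) = (w * a) +√ (w * b)

  private
    square-scale : ∀ w x → (w * x) * (w * x) ≡ (w * w) * (x * x)
    square-scale = solve-∀ ℚ-ring

    square-scale-d : ∀ w x d → (w * x) * (w * x) * d ≡ (w * w) * (x * x * d)
    square-scale-d = solve-∀ ℚ-ring

  nonNeg-scale : ∀ {w} z → 0ℚ < w → NonNeg D z → NonNeg D (scale w z)
  nonNeg-scale {w} (a +√ b) 0<w (inj₁ (0≤a , 0≤b)) =
    inj₁ (*-nonNeg (ℚP.<⇒≤ 0<w) 0≤a , *-nonNeg (ℚP.<⇒≤ 0<w) 0≤b)
  nonNeg-scale {w} (a +√ b) 0<w (inj₂ (inj₁ (0≤a , b<0 , b²d≤a²))) =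
    inj₂ (inj₁ (*-nonNeg (ℚP.<⇒≤ 0<w) 0≤a , *-pos-neg 0<w b<0 ,
      subst₂ _≤_ (sym (square-scale-d w b d)) (sym (square-scale w a))
        (*-monoˡ-≤-nonNeg (*-nonNeg (ℚP.<⇒≤ 0<w) (ℚP.<⇒≤ 0<w)) b²d≤a²)))
  nonNeg-scale {w} (a +√ b) 0<w (inj₂ (inj₂ (a<0 , 0<b , a²≤b²d))) =
    inj₂ (inj₂ (*-pos-neg 0<w a<0 , *-pos 0<w 0<b ,
      subst₂ _≤_ (sym (square-scale w a)) (sym (square-scale-d w b d))
        (*-monoˡ-≤-nonNeg (*-nonNeg (ℚP.<⇒≤ 0<w) (ℚP.<⇒≤ 0<w)) a²≤b²d)))

  norm≤0⇒nonNeg : ∀ z → 0ℚ < im z → norm z ≤ 0ℚ → NonNeg D z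
  norm≤0⇒nonNeg (a +√ b) 0<b N≤0 with 0ℚ ℚ.≤? a
  ... | yes 0≤a = inj₁ (0≤a , ℚP.<⇒≤ 0<b)
  ... | no  0≰a = inj₂ (inj₂ (ℚP.≰⇒> 0≰a , 0<b , x-y≤0⇒x≤y N≤0))

  norm≥0⇒nonNeg : ∀ z → im z < 0ℚ → 0ℚ ≤ re z → 0ℚ ≤ norm z → NonNeg D z
  norm≥0⇒nonNeg (a +√ b) b<0 0≤a 0≤N = inj₂ (inj₁ (0≤a , b<0 , 0≤y-x⇒x≤y 0≤N))

-- Units of the ring of integers

module _ (D : ℕ) where
  open QuadraticField D

  algInt-trace-norm : ∀ x → im x ≢ 0ℚ → IsAlgInt D x
    → ∃[ T ] ∃[ c ] (re x + re x ≡ ofℤ T × norm x ≡ ofℤ c)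
  algInt-trace-norm (a +√ b) b≢0 (c₁ , c₀ , root) = ℤ.- c₁ , c₀ , trace-eq , norm-eq
    where
    open ≡-Reasoning
    C₁ = ofℤ c₁
    C₀ = ofℤ c₀
    b[2a+C₁]≡0 : b * (a + a + C₁) ≡ 0ℚ
    b[2a+C₁]≡0 = trans (im-part a b C₁) (cong im root)
      where
      im-part : ∀ a b C₁ → b * (a + a + C₁) ≡ ((a * b + b * a) + (C₁ * b + 0ℚ * a)) + 0ℚ
      im-part = solve-∀ ℚ-ring
    2a+C₁≡0 : a + a + C₁ ≡ 0ℚ
    2a+C₁≡0 = x*y≡0⇒y≡0 b≢0 b[2a+C₁]≡0
    trace-eq : a + a ≡ ofℤ (ℤ.- c₁)
    trace-eq = begin
      a + a               ≡⟨ move a C₁ ⟩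
      (a + a + C₁) - C₁   ≡⟨ cong (_- C₁) 2a+C₁≡0 ⟩
      0ℚ - C₁             ≡⟨ ℚP.+-identityˡ (- C₁) ⟩
      - C₁                ≡⟨ sym (ofℤ-neg c₁) ⟩
      ofℤ (ℤ.- c₁)        ∎
      where
      move : ∀ a C₁ → a + a ≡ (a + a + C₁) - C₁
      move = solve-∀ ℚ-ring
    norm-eq : a * a - b * b * d ≡ C₀
    norm-eq = begin
      a * a - b * b * d                                                  ≡⟨ eliminate a b C₁ C₀ d ⟩
      C₀ - (((a * a + b * b * d) + (C₁ * a + 0ℚ * b * d)) + C₀) + (a + a + C₁) * a
        ≡⟨ cong₂ (λ r s → C₀ - r + s * a) (cong re root) 2a+C₁≡0 ⟩
      C₀ - 0ℚ + 0ℚ * a                                                   ≡⟨ cleanup C₀ a ⟩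
      C₀                                                                 ∎
      where
      eliminate : ∀ a b C₁ C₀ d → a * a - b * b * d
        ≡ C₀ - (((a * a + b * b * d) + (C₁ * a + 0ℚ * b * d)) + C₀) + (a + a + C₁) * a
      eliminate = solve-∀ ℚ-ring
      cleanup : ∀ C₀ a → C₀ - 0ℚ + 0ℚ * a ≡ C₀
      cleanup = solve-∀ ℚ-ring

  inverse-im≢0 : ∀ x y → im x ≢ 0ℚ → mul D x y ≡ oneQ → im y ≢ 0ℚ
  inverse-im≢0 (a +√ b) (u +√ v) b≢0 xy≡1 v≡0 = ℚP.1≢0 (begin
    1ℚ                        ≡⟨ cong re xy≡1 ⟨
    a * u + b * v * d         ≡⟨ cong₂ (λ u v → a * u + b * v * d) u≡0 v≡0 ⟩
    a * 0ℚ + b * 0ℚ * d       ≡⟨ vanish a b d ⟩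
    0ℚ                        ∎)
    where
    open ≡-Reasoning
    vanish : ∀ a b d → a * 0ℚ + b * 0ℚ * d ≡ 0ℚ
    vanish = solve-∀ ℚ-ring
    bu≡0 : b * u ≡ 0ℚ
    bu≡0 = begin
      b * u              ≡⟨ shift a b u ⟩
      a * 0ℚ + b * u     ≡⟨ cong (λ v → a * v + b * u) v≡0 ⟨
      a * v + b * u      ≡⟨ cong im xy≡1 ⟩
      0ℚ                 ∎
      where
      shift : ∀ a b u → b * u ≡ a * 0ℚ + b * u
      shift = solve-∀ ℚ-ring
    u≡0 : u ≡ 0ℚ
    u≡0 = x*y≡0⇒y≡0 b≢0 bu≡0

  unit-trace-norm : ∀ x → im x ≢ 0ℚ → IsUnitOfIntegers D x
    → ∃[ T ] ∃[ c ] (re x + re x ≡ ofℤ T × norm x ≡ ofℤ c × (c ≡ 1ℤ ⊎ c ≡ -1ℤ))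
  unit-trace-norm x imx≢0 (x-int , y , y-int , xy≡1) =
    combine (algInt-trace-norm x imx≢0 x-int) (algInt-trace-norm y (inverse-im≢0 x y imx≢0 xy≡1) y-int)
    where
    open ≡-Reasoning
    norm-one : ∀ d → 1ℚ * 1ℚ - 0ℚ * 0ℚ * d ≡ 1ℚ
    norm-one = solve-∀ ℚ-ring
    combine : ∃[ T ] ∃[ c ] (re x + re x ≡ ofℤ T × norm x ≡ ofℤ c)
            → ∃[ T ] ∃[ c ] (re y + re y ≡ ofℤ T × norm y ≡ ofℤ c)
            → ∃[ T ] ∃[ c ] (re x + re x ≡ ofℤ T × norm x ≡ ofℤ c × (c ≡ 1ℤ ⊎ c ≡ -1ℤ))
    combine (T , c , trace-x , norm-x) (_ , c' , _ , norm-y) =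
      T , c , trace-x , norm-x , i*j≡1⇒i≡±1 c c' (ofℤ-injective (begin
        ofℤ (c ℤ.* c')            ≡⟨ ofℤ-* c c' ⟩
        ofℤ c * ofℤ c'            ≡⟨ cong₂ _*_ norm-x norm-y ⟨
        norm x * norm y           ≡⟨ norm-mul x y ⟨
        norm (mul D x y)          ≡⟨ cong norm xy≡1 ⟩
        norm oneQ                 ≡⟨ norm-one d ⟩
        1ℚ                        ∎))

coprime-square : ∀ {u s D} → Coprime u s → u ℕ.* u ℕ.* D ≡ s ℕ.* s → D ≡ s ℕ.* s
coprime-square {u} {s} {D} u⊥s uuD≡ss = begin
  D                  ≡⟨ ℕP.*-identityˡ D ⟨
  1 ℕ.* 1 ℕ.* D      ≡⟨ cong (λ v → v ℕ.* v ℕ.* D) u≡1 ⟨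
  u ℕ.* u ℕ.* D      ≡⟨ uuD≡ss ⟩
  s ℕ.* s            ∎
  where
  open ≡-Reasoning
  u∣ss : u ∣ s ℕ.* s
  u∣ss = divides (u ℕ.* D) (trans (sym uuD≡ss) (trans (ℕP.*-assoc u u D) (ℕP.*-comm u (u ℕ.* D))))
  u≡1 : u ≡ 1
  u≡1 = u⊥s (∣-refl , coprime-divisor u⊥s u∣ss)

nonSquare-irrational : ∀ {D} → NonSquare D → ∀ b → b * b * ofℤ (+ D) ≢ 1ℚ
nonSquare-irrational {D} nonSquare b@(mkℚ n m n⊥m) bbD≡1 =
  nonSquare (suc m) (sym (coprime-square (Coprimality.recompute n⊥m) (begin
    ℤ.∣ n ∣ ℕ.* ℤ.∣ n ∣ ℕ.* D               ≡⟨ cong (ℕ._* D) (ℤP.abs-* n n) ⟨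
    ℤ.∣ n ℤ.* n ∣ ℕ.* D                     ≡⟨ ℤP.abs-* (n ℤ.* n) (+ D) ⟨
    ℤ.∣ n ℤ.* n ℤ.* + D ∣                   ≡⟨ cong ℤ.∣_∣ (ℤP.*-identityʳ (n ℤ.* n ℤ.* + D)) ⟨
    ℤ.∣ n ℤ.* n ℤ.* + D ℤ.* + 1 ∣           ≡⟨ cong ℤ.∣_∣ cross ⟩
    ℤ.∣ + 1 ℤ.* + (suc m ℕ.* suc m ℕ.* 1) ∣ ≡⟨ cong ℤ.∣_∣ (ℤP.*-identityˡ (+ (suc m ℕ.* suc m ℕ.* 1))) ⟩
    suc m ℕ.* suc m ℕ.* 1                    ≡⟨ ℕP.*-identityʳ (suc m ℕ.* suc m) ⟩
    suc m ℕ.* suc m                          ∎)))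
  where
  open ≡-Reasoning
  unnormalised : (ℚᵘ.mkℚᵘ n m ℚᵘ.* ℚᵘ.mkℚᵘ n m) ℚᵘ.* ℚᵘ.mkℚᵘ (+ D) 0 ℚᵘ.≃ ℚ.toℚᵘ 1ℚ
  unnormalised = ℚᵘP.≃-trans
    (ℚᵘP.≃-sym (ℚᵘP.*-cong (ℚP.toℚᵘ-homo-* b b) (toℚᵘ-ofℤ (+ D))))
    (ℚᵘP.≃-trans (ℚᵘP.≃-sym (ℚP.toℚᵘ-homo-* (b * b) (ofℤ (+ D)))) (ℚP.toℚᵘ-cong bbD≡1))
  cross : n ℤ.* n ℤ.* + D ℤ.* + 1 ≡ + 1 ℤ.* + (suc m ℕ.* suc m ℕ.* 1)
  cross with unnormalised
  ... | ℚᵘ.*≡* eq = eq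

-- For a unit a + b√D of trace T and norm c, Δ = T² − 4c equals (2b)²D and (T − 2)² equals (2a − 2)²,
-- so the three cases of a + b√D ≥ 1 become comparisons between these integers.
square-minus-disc : ∀ T c
  → (T ℤ.- + 2) ℤ.* (T ℤ.- + 2) ℤ.- (T ℤ.* T ℤ.- + 4 ℤ.* c) ≡ + 4 ℤ.* ((c ℤ.+ 1ℤ) ℤ.- T)
square-minus-disc = solve-∀ ℤ-ring

disc≤square⇒T≤c+1 : ∀ T c → T ℤ.* T ℤ.- + 4 ℤ.* c ℤ.≤ (T ℤ.- + 2) ℤ.* (T ℤ.- + 2)
  → T ℤ.≤ c ℤ.+ 1ℤ
disc≤square⇒T≤c+1 T c Δ≤U² = ℤP.0≤i-j⇒j≤i (ℤP.*-cancelˡ-≤-pos (+ 0) _ (+ 4)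
  (subst (+ 0 ℤ.≤_) (square-minus-disc T c) (ℤP.i≤j⇒0≤j-i Δ≤U²)))

square≤disc⇒c+1≤T : ∀ T c → (T ℤ.- + 2) ℤ.* (T ℤ.- + 2) ℤ.≤ T ℤ.* T ℤ.- + 4 ℤ.* c
  → c ℤ.+ 1ℤ ℤ.≤ T
square≤disc⇒c+1≤T T c U²≤Δ = ℤP.0≤i-j⇒j≤i (ℤP.*-cancelˡ-≤-pos (+ 0) _ (+ 4)
  (subst (+ 0 ℤ.≤_) (disc-minus-square T c) (ℤP.i≤j⇒0≤j-i U²≤Δ)))
  where
  disc-minus-square : ∀ T c
    → T ℤ.* T ℤ.- + 4 ℤ.* c ℤ.- (T ℤ.- + 2) ℤ.* (T ℤ.- + 2) ≡ + 4 ℤ.* (T ℤ.- (c ℤ.+ 1ℤ))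
  disc-minus-square = solve-∀ ℤ-ring

2≤T⇒3≤T²-2c : ∀ T c → c ≡ 1ℤ ⊎ c ≡ -1ℤ → T ℤ.* T ℤ.- + 4 ℤ.* c ≢ + 0 → + 2 ℤ.≤ T
  → + 3 ℤ.≤ T ℤ.* T ℤ.- + 2 ℤ.* c
2≤T⇒3≤T²-2c (+ 2)                   _ (inj₁ refl) Δ≢0 _ = ⊥-elim (Δ≢0 refl)
2≤T⇒3≤T²-2c (+ suc (suc (suc j)))   _ (inj₁ refl) _   _ = ≤-by-horner (4 ∷ 6 ∷ 1 ∷ []) j (growth (+ j))
  where
  growth : ∀ κ → (+ 3 ℤ.+ κ) ℤ.* (+ 3 ℤ.+ κ) ℤ.- + 2 ℤ.* 1ℤ
               ≡ + 3 ℤ.+ (+ 4 ℤ.+ κ ℤ.* (+ 6 ℤ.+ κ ℤ.* + 1))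
  growth = solve-∀ ℤ-ring
2≤T⇒3≤T²-2c (+ suc (suc j))         _ (inj₂ refl) _   _ = ≤-by-horner (3 ∷ 4 ∷ 1 ∷ []) j (growth (+ j))
  where
  growth : ∀ κ → (+ 2 ℤ.+ κ) ℤ.* (+ 2 ℤ.+ κ) ℤ.- + 2 ℤ.* -1ℤ
               ≡ + 3 ℤ.+ (+ 3 ℤ.+ κ ℤ.* (+ 4 ℤ.+ κ ℤ.* + 1))
  growth = solve-∀ ℤ-ring
2≤T⇒3≤T²-2c (+ 0)       _ _ _ (ℤ.+≤+ ())
2≤T⇒3≤T²-2c (+ 1)       _ _ _ (ℤ.+≤+ (ℕ.s≤s ()))
2≤T⇒3≤T²-2c -[1+ _ ]    _ _ _ ()

2≤T⇒disc≰square : ∀ T c → c ≡ 1ℤ ⊎ c ≡ -1ℤ → T ℤ.* T ℤ.- + 4 ℤ.* c ≢ + 0 → + 2 ℤ.≤ T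
  → ¬ (T ℤ.* T ℤ.- + 4 ℤ.* c ℤ.≤ (T ℤ.- + 2) ℤ.* (T ℤ.- + 2))
2≤T⇒disc≰square T c c≡±1 Δ≢0 2≤T Δ≤U² with c≡±1 | disc≤square⇒T≤c+1 T c Δ≤U²
... | inj₁ refl | T≤2 = Δ≢0 (cong (λ T → T ℤ.* T ℤ.- + 4 ℤ.* 1ℤ) (ℤP.≤-antisym T≤2 2≤T))
... | inj₂ refl | T≤0 with ℤP.≤-trans 2≤T T≤0
...   | ℤ.+≤+ ()

2≰T⇒T≡1×c≡-1 : ∀ T c → c ≡ 1ℤ ⊎ c ≡ -1ℤ → T ℤ.* T ℤ.- + 4 ℤ.* c ≢ + 4 → ¬ (+ 2 ℤ.≤ T)
  → (T ℤ.- + 2) ℤ.* (T ℤ.- + 2) ℤ.≤ T ℤ.* T ℤ.- + 4 ℤ.* c → T ≡ 1ℤ × c ≡ -1ℤ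
2≰T⇒T≡1×c≡-1 T c c≡±1 Δ≢4 T≱2 U²≤Δ with c≡±1 | square≤disc⇒c+1≤T T c U²≤Δ
... | inj₁ refl | 2≤T = ⊥-elim (T≱2 2≤T)
... | inj₂ refl | 0≤T = 0≤T<2⇒T≡1 T 0≤T Δ≢4 T≱2
  where
  0≤T<2⇒T≡1 : ∀ T → + 0 ℤ.≤ T → T ℤ.* T ℤ.- + 4 ℤ.* -1ℤ ≢ + 4 → ¬ (+ 2 ℤ.≤ T)
    → T ≡ 1ℤ × -1ℤ ≡ -1ℤ
  0≤T<2⇒T≡1 (+ 0)             _ Δ≢4 _   = ⊥-elim (Δ≢4 refl)
  0≤T<2⇒T≡1 (+ 1)             _ _   _   = refl , refl
  0≤T<2⇒T≡1 (+ suc (suc j))   _ _   T≱2 = ⊥-elim (T≱2 (ℤ.+≤+ (ℕ.s≤s (ℕ.s≤s ℕ.z≤n))))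

module _ (D : ℕ) (nonSquare : NonSquare D) where
  open QuadraticField D

  d≢0 : d ≢ 0ℚ
  d≢0 d≡0 = nonSquare 0 (sym (ℤP.+-injective (ofℤ-injective d≡0)))

  module UnitAboveOne {a b : ℚ} (T c : ℤ) (b≢0 : b ≢ 0ℚ) (trace-eq : a + a ≡ ofℤ T)
                      (norm-eq : norm (a +√ b) ≡ ofℤ c) (c≡±1 : c ≡ 1ℤ ⊎ c ≡ -1ℤ) where

    u two four : ℚ
    u    = a + - 1ℚ
    two  = ofℤ (+ 2)
    four = ofℤ (+ 4)

    Δ U : ℤ
    Δ = T ℤ.* T ℤ.- + 4 ℤ.* c
    U = T ℤ.- + 2

    ofℤ-U : ofℤ U ≡ two * u
    ofℤ-U = begin
      ofℤ U                  ≡⟨ ofℤ-- T (+ 2) ⟩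
      ofℤ T - two            ≡⟨ cong (_- two) trace-eq ⟨
      a + a - two            ≡⟨ identity a ⟩
      two * u                ∎
      where
      open ≡-Reasoning
      identity : ∀ a → a + a - ofℤ (+ 2) ≡ ofℤ (+ 2) * (a + - 1ℚ)
      identity = solve-∀ ℚ-ring

    ofℤ-U² : ofℤ (U ℤ.* U) ≡ four * (u * u)
    ofℤ-U² = begin
      ofℤ (U ℤ.* U)          ≡⟨ ofℤ-* U U ⟩
      ofℤ U * ofℤ U          ≡⟨ cong₂ _*_ ofℤ-U ofℤ-U ⟩
      (two * u) * (two * u)  ≡⟨ identity u ⟩
      four * (u * u)         ∎
      where
      open ≡-Reasoning
      identity : ∀ u → (ofℤ (+ 2) * u) * (ofℤ (+ 2) * u) ≡ ofℤ (+ 4) * (u * u)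
      identity = solve-∀ ℚ-ring

    ofℤ-Δ : ofℤ Δ ≡ four * (b * b * d)
    ofℤ-Δ = begin
      ofℤ Δ                                           ≡⟨ ofℤ-- (T ℤ.* T) (+ 4 ℤ.* c) ⟩
      ofℤ (T ℤ.* T) - ofℤ (+ 4 ℤ.* c)                 ≡⟨ cong₂ _-_ (ofℤ-* T T) (ofℤ-* (+ 4) c) ⟩
      ofℤ T * ofℤ T - four * ofℤ c                    ≡⟨ cong₂ (λ t n → t * t - four * n) trace-eq norm-eq ⟨
      (a + a) * (a + a) - four * (a * a - b * b * d)  ≡⟨ identity a b d ⟩
      four * (b * b * d)                              ∎
      where
      open ≡-Reasoning
      identity : ∀ a b d → (a + a) * (a + a) - ofℤ (+ 4) * (a * a - b * b * d) ≡ ofℤ (+ 4) * (b * b * d)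
      identity = solve-∀ ℚ-ring

    0<four : 0ℚ < four
    0<four = ℚP.positive⁻¹ four

    Δ≢0 : Δ ≢ + 0
    Δ≢0 Δ≡0 = d≢0 (x*y≡0⇒y≡0 b²≢0
      (x*y≡0⇒y≡0 (ℚP.<⇒≢ 0<four ∘ sym) (trans (sym ofℤ-Δ) (cong ofℤ Δ≡0))))
      where
      b²≢0 : b * b ≢ 0ℚ
      b²≢0 b²≡0 = b≢0 (x*y≡0⇒y≡0 b≢0 b²≡0)

    Δ≢4 : Δ ≢ + 4
    Δ≢4 Δ≡4 = nonSquare-irrational nonSquare b
      (*-cancelˡ-≡-pos 0<four (trans (sym ofℤ-Δ) (trans (cong ofℤ Δ≡4) (sym (ℚP.*-identityʳ four)))))

    quadruple : ∀ {x y} → x ≤ y → four * x ≤ four * y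
    quadruple = *-monoˡ-≤-nonNeg (ℚP.<⇒≤ 0<four)

    2≤T : 0ℚ ≤ u → + 2 ℤ.≤ T
    2≤T 0≤u = ℤP.0≤i-j⇒j≤i (ofℤ-cancel-≤
      (subst (0ℚ ≤_) (sym ofℤ-U) (*-monoˡ-≤-nonNeg (ℚP.nonNegative⁻¹ two) 0≤u)))

    2≰T : u < 0ℚ → ¬ (+ 2 ℤ.≤ T)
    2≰T u<0 2≤T = ℚP.<-irrefl refl (ℚP.<-≤-trans u<0
      (ℚP.*-cancelˡ-≤-pos two (subst (0ℚ ≤_) ofℤ-U (ofℤ-mono-≤ (ℤP.i≤j⇒0≤j-i 2≤T)))))

    a-pos : + 1 ℤ.≤ T → 0ℚ < a
    a-pos 1≤T = ℚP.*-cancelˡ-<-nonNeg two (subst (0ℚ <_) (trans (sym trace-eq) (double a))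
      (ℚP.<-≤-trans (ℚP.positive⁻¹ 1ℚ) (ofℤ-mono-≤ 1≤T)))
      where
      double : ∀ a → a + a ≡ ofℤ (+ 2) * a
      double = solve-∀ ℚ-ring

    b-pos : 0ℚ ≤ b → 0ℚ < b
    b-pos 0≤b = ℚP.positive⁻¹ b {{ℚP.nonNeg∧nonZero⇒pos b {{ℚ.nonNegative 0≤b}} {{ℚ.≢-nonZero b≢0}}}}

    unit>1-bounds : LtQ D oneQ (a +√ b) → 0ℚ < a × 0ℚ < b × + 3 ℤ.≤ T ℤ.* T ℤ.- + 2 ℤ.* c
    unit>1-bounds (α≥1 , _) = classify (subst (NonNeg D) (cong (λ v → u +√ v) (ℚP.+-identityʳ b)) α≥1)
      where
      classify : NonNeg D (u +√ b) → 0ℚ < a × 0ℚ < b × + 3 ℤ.≤ T ℤ.* T ℤ.- + 2 ℤ.* c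
      classify (inj₁ (0≤u , 0≤b)) =
        a-pos (ℤP.≤-trans (ℤ.+≤+ (ℕ.s≤s ℕ.z≤n)) (2≤T 0≤u)) , b-pos 0≤b ,
        2≤T⇒3≤T²-2c T c c≡±1 Δ≢0 (2≤T 0≤u)
      classify (inj₂ (inj₁ (0≤u , _ , b²d≤u²))) = ⊥-elim (2≤T⇒disc≰square T c c≡±1 Δ≢0 (2≤T 0≤u)
        (ofℤ-cancel-≤ (subst₂ _≤_ (sym ofℤ-Δ) (sym ofℤ-U²) (quadruple b²d≤u²))))
      classify (inj₂ (inj₂ (u<0 , 0<b , u²≤b²d))) = from-1 (2≰T⇒T≡1×c≡-1 T c c≡±1 Δ≢4 (2≰T u<0)
        (ofℤ-cancel-≤ (subst₂ _≤_ (sym ofℤ-U²) (sym ofℤ-Δ) (quadruple u²≤b²d))))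
        where
        from-1 : T ≡ 1ℤ × c ≡ -1ℤ → 0ℚ < a × 0ℚ < b × + 3 ℤ.≤ T ℤ.* T ℤ.- + 2 ℤ.* c
        from-1 (T≡1 , c≡-1) = a-pos (ℤP.≤-reflexive (sym T≡1)) , 0<b ,
          subst₂ (λ T c → + 3 ℤ.≤ T ℤ.* T ℤ.- + 2 ℤ.* c) (sym T≡1) (sym c≡-1) ℤP.≤-refl

-- Powers of a unit of norm one

lucas : ℤ → ℕ → ℤ
lucas τ zero          = + 2
lucas τ (suc zero)    = τ
lucas τ (suc (suc j)) = τ ℤ.* lucas τ (suc j) ℤ.- lucas τ j

lucas-growth : ∀ {τ} → + 3 ℤ.≤ τ → ∀ j → + 2 ℤ.+ + j ℤ.≤ lucas τ j
lucas-growth {τ} 3≤τ j = proj₂ (invariant j)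
  where
  invariant : ∀ j → (+ 1 ℤ.+ lucas τ j ℤ.≤ lucas τ (suc j)) × (+ 2 ℤ.+ + j ℤ.≤ lucas τ j)
  invariant zero    = 3≤τ , ℤP.≤-refl
  invariant (suc j) with invariant j
  ... | y<x , j+2≤y = ≤-by-slack slack-nonNeg (split τ x y) , j+3≤x
    where
    x = lucas τ (suc j)
    y = lucas τ j
    j+3≤x : + 2 ℤ.+ + suc j ℤ.≤ x
    j+3≤x = ℤP.≤-trans (ℤP.+-monoʳ-≤ (+ 1) j+2≤y) y<x
    0≤x : + 0 ℤ.≤ x
    0≤x = ℤP.≤-trans (ℤ.+≤+ ℕ.z≤n) j+3≤x
    split : ∀ τ x y → τ ℤ.* x ℤ.- y ≡ (+ 1 ℤ.+ x) ℤ.+ ((τ ℤ.- + 3) ℤ.* x ℤ.+ (x ℤ.- (+ 1 ℤ.+ y)) ℤ.+ x)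
    split = solve-∀ ℤ-ring
    slack-nonNeg : + 0 ℤ.≤ (τ ℤ.- + 3) ℤ.* x ℤ.+ (x ℤ.- (+ 1 ℤ.+ y)) ℤ.+ x
    slack-nonNeg = ℤP.+-mono-≤ (ℤP.+-mono-≤
      (ℤP.*-monoʳ-≤-nonNeg x {{ℤ.nonNegative 0≤x}} (ℤP.i≤j⇒0≤j-i 3≤τ)) (ℤP.i≤j⇒0≤j-i y<x)) 0≤x

module _ (D : ℕ) where
  open QuadraticField D

  module NormOnePowers (p q : ℚ) (τ : ℤ) (trace : p + p ≡ ofℤ τ) (norm≡1 : norm (p +√ q) ≡ 1ℚ) where

    β : Q√
    β = p +√ q

    re-recurrence : ∀ x → re (mul D β (mul D β x)) ≡ (p + p) * re (mul D β x) - re x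
    re-recurrence (u +√ v) = begin
      p * (p * u + q * v * d) + q * (p * v + q * u) * d
        ≡⟨ cayley-hamilton p q u v d ⟩
      (p + p) * (p * u + q * v * d) - u + u * (1ℚ - (p * p - q * q * d))
        ≡⟨ cong (λ N → (p + p) * (p * u + q * v * d) - u + u * (1ℚ - N)) norm≡1 ⟩
      (p + p) * (p * u + q * v * d) - u + u * (1ℚ - 1ℚ)
        ≡⟨ cleanup ((p + p) * (p * u + q * v * d) - u) u ⟩
      (p + p) * (p * u + q * v * d) - u ∎
      where
      open ≡-Reasoning
      cayley-hamilton : ∀ p q u v d → p * (p * u + q * v * d) + q * (p * v + q * u) * d
        ≡ (p + p) * (p * u + q * v * d) - u + u * (1ℚ - (p * p - q * q * d))
      cayley-hamilton = solve-∀ ℚ-ring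
      cleanup : ∀ r u → r + u * (1ℚ - 1ℚ) ≡ r
      cleanup = solve-∀ ℚ-ring

    trace-pow : ∀ j → re (pow D β j) + re (pow D β j) ≡ ofℤ (lucas τ j)
    trace-pow zero          = refl
    trace-pow (suc zero)    = trans (cong (λ x → re x + re x) (mul-identityʳ β)) trace
    trace-pow (suc (suc j)) = begin
      r₂ + r₂                                          ≡⟨ cong (λ x → x + x) (re-recurrence (pow D β j)) ⟩
      (p + p) * r₁ - r₀ + ((p + p) * r₁ - r₀)          ≡⟨ regroup (p + p) r₁ r₀ ⟩
      (p + p) * (r₁ + r₁) - (r₀ + r₀)                  ≡⟨ cong₂ (λ t s → t * s - (r₀ + r₀)) trace (trace-pow (suc j)) ⟩
      ofℤ τ * ofℤ (lucas τ (suc j)) - (r₀ + r₀)        ≡⟨ cong (λ s → ofℤ τ * ofℤ (lucas τ (suc j)) - s) (trace-pow j) ⟩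
      ofℤ τ * ofℤ (lucas τ (suc j)) - ofℤ (lucas τ j)  ≡⟨ cong (_- ofℤ (lucas τ j)) (ofℤ-* τ (lucas τ (suc j))) ⟨
      ofℤ (τ ℤ.* lucas τ (suc j)) - ofℤ (lucas τ j)    ≡⟨ ofℤ-- (τ ℤ.* lucas τ (suc j)) (lucas τ j) ⟨
      ofℤ (lucas τ (suc (suc j)))                      ∎
      where
      open ≡-Reasoning
      r₀ = re (pow D β j)
      r₁ = re (pow D β (suc j))
      r₂ = re (pow D β (suc (suc j)))
      regroup : ∀ t r₁ r₀ → t * r₁ - r₀ + (t * r₁ - r₀) ≡ t * (r₁ + r₁) - (r₀ + r₀)
      regroup = solve-∀ ℚ-ring

    norm-pow : ∀ j → norm (pow D β j) ≡ 1ℚ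
    norm-pow zero    = norm-one d
      where
      norm-one : ∀ d → 1ℚ * 1ℚ - 0ℚ * 0ℚ * d ≡ 1ℚ
      norm-one = solve-∀ ℚ-ring
    norm-pow (suc j) = begin
      norm (mul D β (pow D β j))   ≡⟨ norm-mul β (pow D β j) ⟩
      norm β * norm (pow D β j)    ≡⟨ cong₂ _*_ norm≡1 (norm-pow j) ⟩
      1ℚ * 1ℚ                      ≡⟨ ℚP.*-identityˡ 1ℚ ⟩
      1ℚ                           ∎
      where open ≡-Reasoning

    module _ (0<p : 0ℚ < p) (0<q : 0ℚ < q) where

      mul-pos : ∀ x → 0ℚ < re x → 0ℚ ≤ im x → 0ℚ < re (mul D β x) × 0ℚ < im (mul D β x)
      mul-pos (u +√ v) 0<u 0≤v =
        ℚP.+-mono-<-≤ (*-pos 0<p 0<u) (*-nonNeg (*-nonNeg (ℚP.<⇒≤ 0<q) 0≤v) 0≤d) ,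
        ℚP.+-mono-≤-< (*-nonNeg (ℚP.<⇒≤ 0<p) 0≤v) (*-pos 0<q 0<u)

      pow-pos : ∀ j → 0ℚ < re (pow D β j) × 0ℚ ≤ im (pow D β j)
      pow-pos zero    = ℚP.positive⁻¹ 1ℚ , ℚP.≤-refl
      pow-pos (suc j) = map₂ ℚP.<⇒≤ (mul-pos (pow D β j) (proj₁ (pow-pos j)) (proj₂ (pow-pos j)))

      im-pow-pos : ∀ j → 0ℚ < im (pow D β (suc j))
      im-pow-pos j = proj₂ (mul-pos (pow D β j) (proj₁ (pow-pos j)) (proj₂ (pow-pos j)))

-- Complete quotients (P + θ)/Q

module _ (D : ℕ) where
  open QuadraticField D

  -- θ is a root of X² − sX + n with im θ > 0, and quotient P w stands for (P + θ)/Q when w = 1/Q.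
  module CompleteQuotients (θ : Q√) (s n : ℤ)
         (θ-trace : re θ + re θ ≡ ofℤ s) (θ-norm : norm θ ≡ ofℤ n) (0<imθ : 0ℚ < im θ) where

    quotient : ℤ → ℚ → Q√
    quotient P w = scale w (embℤ P ⊕ θ)

    quotient-minus : ∀ {P Q m w} → w * ofℤ Q ≡ 1ℚ → quotient P w ⊖ embℤ m ≡ quotient (P ℤ.- m ℤ.* Q) w
    quotient-minus {P} {Q} {m} {w} wQ≡1 = cong₂ _+√_ re-eq (ℚP.+-identityʳ (w * (0ℚ + im θ)))
      where
      open ≡-Reasoning
      re-eq : w * (ofℤ P + re θ) + - ofℤ m ≡ w * (ofℤ (P ℤ.- m ℤ.* Q) + re θ)
      re-eq = begin
        w * (ofℤ P + re θ) + - ofℤ m                    ≡⟨ cong (λ z → w * (ofℤ P + re θ) + - z) (ℚP.*-identityʳ (ofℤ m)) ⟨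
        w * (ofℤ P + re θ) + - (ofℤ m * 1ℚ)             ≡⟨ cong (λ z → w * (ofℤ P + re θ) + - (ofℤ m * z)) wQ≡1 ⟨
        w * (ofℤ P + re θ) + - (ofℤ m * (w * ofℤ Q))    ≡⟨ distrib w (ofℤ P) (ofℤ m) (ofℤ Q) (re θ) ⟩
        w * (ofℤ P - ofℤ m * ofℤ Q + re θ)              ≡⟨ cong (λ z → w * (ofℤ P - z + re θ)) (ofℤ-* m Q) ⟨
        w * (ofℤ P - ofℤ (m ℤ.* Q) + re θ)              ≡⟨ cong (λ z → w * (z + re θ)) (ofℤ-- P (m ℤ.* Q)) ⟨
        w * (ofℤ (P ℤ.- m ℤ.* Q) + re θ)                ∎
        where
        distrib : ∀ w P m Q u → w * (P + u) + - (m * (w * Q)) ≡ w * (P - m * Q + u)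
        distrib = solve-∀ ℚ-ring

    minus-quotient : ∀ {P Q m w} → w * ofℤ Q ≡ 1ℚ
      → embℤ m ⊖ quotient P w ≡ scale w (embℤ (m ℤ.* Q ℤ.- P) ⊖ θ)
    minus-quotient {P} {Q} {m} {w} wQ≡1 = cong₂ _+√_ re-eq (im-eq w (im θ))
      where
      open ≡-Reasoning
      re-eq : ofℤ m + - (w * (ofℤ P + re θ)) ≡ w * (ofℤ (m ℤ.* Q ℤ.- P) + - re θ)
      re-eq = begin
        ofℤ m + - (w * (ofℤ P + re θ))                  ≡⟨ cong (λ z → z + - (w * (ofℤ P + re θ))) (ℚP.*-identityʳ (ofℤ m)) ⟨
        ofℤ m * 1ℚ + - (w * (ofℤ P + re θ))             ≡⟨ cong (λ z → ofℤ m * z + - (w * (ofℤ P + re θ))) wQ≡1 ⟨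
        ofℤ m * (w * ofℤ Q) + - (w * (ofℤ P + re θ))    ≡⟨ distrib w (ofℤ P) (ofℤ m) (ofℤ Q) (re θ) ⟩
        w * (ofℤ m * ofℤ Q - ofℤ P + - re θ)            ≡⟨ cong (λ z → w * (z - ofℤ P + - re θ)) (ofℤ-* m Q) ⟨
        w * (ofℤ (m ℤ.* Q) - ofℤ P + - re θ)            ≡⟨ cong (λ z → w * (z + - re θ)) (ofℤ-- (m ℤ.* Q) P) ⟨
        w * (ofℤ (m ℤ.* Q ℤ.- P) + - re θ)              ∎
        where
        distrib : ∀ w P m Q u → m * (w * Q) + - (w * (P + u)) ≡ w * (m * Q - P + - u)
        distrib = solve-∀ ℚ-ring
      im-eq : ∀ w v → 0ℚ + - (w * (0ℚ + v)) ≡ w * (0ℚ + - v)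
      im-eq = solve-∀ ℚ-ring

    norm-plus : ∀ x → norm (embℤ x ⊕ θ) ≡ ofℤ (x ℤ.* x ℤ.+ s ℤ.* x ℤ.+ n)
    norm-plus x = begin
      (X + re θ) * (X + re θ) - (0ℚ + im θ) * (0ℚ + im θ) * d   ≡⟨ expand X (re θ) (im θ) d ⟩
      X * X + (re θ + re θ) * X + norm θ                         ≡⟨ cong₂ (λ S N → X * X + S * X + N) θ-trace θ-norm ⟩
      X * X + ofℤ s * X + ofℤ n                                  ≡⟨ cong₂ (λ a b → a + b + ofℤ n) (ofℤ-* x x) (ofℤ-* s x) ⟨
      ofℤ (x ℤ.* x) + ofℤ (s ℤ.* x) + ofℤ n                      ≡⟨ cong (_+ ofℤ n) (ofℤ-+ (x ℤ.* x) (s ℤ.* x)) ⟨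
      ofℤ (x ℤ.* x ℤ.+ s ℤ.* x) + ofℤ n                          ≡⟨ ofℤ-+ (x ℤ.* x ℤ.+ s ℤ.* x) n ⟨
      ofℤ (x ℤ.* x ℤ.+ s ℤ.* x ℤ.+ n)                            ∎
      where
      open ≡-Reasoning
      X = ofℤ x
      expand : ∀ X u v d → (X + u) * (X + u) - (0ℚ + v) * (0ℚ + v) * d ≡ X * X + (u + u) * X + (u * u - v * v * d)
      expand = solve-∀ ℚ-ring

    norm-minus : ∀ y → norm (embℤ y ⊖ θ) ≡ ofℤ (y ℤ.* y ℤ.- s ℤ.* y ℤ.+ n)
    norm-minus y = begin
      (Y + - re θ) * (Y + - re θ) - (0ℚ + - im θ) * (0ℚ + - im θ) * d   ≡⟨ expand Y (re θ) (im θ) d ⟩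
      Y * Y - (re θ + re θ) * Y + norm θ                                 ≡⟨ cong₂ (λ S N → Y * Y - S * Y + N) θ-trace θ-norm ⟩
      Y * Y - ofℤ s * Y + ofℤ n                                          ≡⟨ cong₂ (λ a b → a - b + ofℤ n) (ofℤ-* y y) (ofℤ-* s y) ⟨
      ofℤ (y ℤ.* y) - ofℤ (s ℤ.* y) + ofℤ n                              ≡⟨ cong (_+ ofℤ n) (ofℤ-- (y ℤ.* y) (s ℤ.* y)) ⟨
      ofℤ (y ℤ.* y ℤ.- s ℤ.* y) + ofℤ n                                  ≡⟨ ofℤ-+ (y ℤ.* y ℤ.- s ℤ.* y) n ⟨
      ofℤ (y ℤ.* y ℤ.- s ℤ.* y ℤ.+ n)                                    ∎
      where
      open ≡-Reasoning
      Y = ofℤ y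
      expand : ∀ Y u v d → (Y + - u) * (Y + - u) - (0ℚ + - v) * (0ℚ + - v) * d ≡ Y * Y - (u + u) * Y + (u * u - v * v * d)
      expand = solve-∀ ℚ-ring

    nonNeg-plus : ∀ x → x ℤ.* x ℤ.+ s ℤ.* x ℤ.+ n ℤ.≤ + 0 → NonNeg D (embℤ x ⊕ θ)
    nonNeg-plus x N≤0 = norm≤0⇒nonNeg (embℤ x ⊕ θ)
      (subst (0ℚ <_) (sym (ℚP.+-identityˡ (im θ))) 0<imθ)
      (subst (_≤ 0ℚ) (sym (norm-plus x)) (ofℤ-mono-≤ N≤0))

    nonNeg-minus : ∀ y → s ℤ.≤ y ℤ.+ y → + 0 ℤ.≤ y ℤ.* y ℤ.- s ℤ.* y ℤ.+ n → NonNeg D (embℤ y ⊖ θ)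
    nonNeg-minus y s≤2y 0≤N = norm≥0⇒nonNeg (embℤ y ⊖ θ)
      (subst (_< 0ℚ) (sym (ℚP.+-identityˡ (- im θ))) (ℚP.neg-antimono-< 0<imθ))
      (0≤x+x⇒0≤x (subst (0ℚ ≤_) doubled (x≤y⇒0≤y-x (ofℤ-mono-≤ s≤2y))))
      (subst (0ℚ ≤_) (sym (norm-minus y)) (ofℤ-mono-≤ 0≤N))
      where
      regroup : ∀ Y u → (Y + Y) - (u + u) ≡ (Y + - u) + (Y + - u)
      regroup = solve-∀ ℚ-ring
      doubled : ofℤ (y ℤ.+ y) - ofℤ s ≡ (ofℤ y + - re θ) + (ofℤ y + - re θ)
      doubled = trans (cong₂ _-_ (ofℤ-+ y y) (sym θ-trace)) (regroup (ofℤ y) (re θ))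

    mul-quotients : ∀ {p q w' w} → p ℤ.+ q ℤ.+ s ≡ + 0 → w' * w * ofℤ (p ℤ.* q ℤ.- n) ≡ 1ℚ
      → mul D (quotient p w') (quotient q w) ≡ oneQ
    mul-quotients {p} {q} {w'} {w} p+q+s≡0 w'wN≡1 = cong₂ _+√_ re-eq im-eq
      where
      open ≡-Reasoning
      A = ofℤ p
      B = ofℤ q
      u = re θ
      v = im θ
      sum≡0 : A + B + (u + u) ≡ 0ℚ
      sum≡0 = begin
        A + B + (u + u)        ≡⟨ cong (λ S → A + B + S) θ-trace ⟩
        A + B + ofℤ s          ≡⟨ cong (_+ ofℤ s) (ofℤ-+ p q) ⟨
        ofℤ (p ℤ.+ q) + ofℤ s  ≡⟨ ofℤ-+ (p ℤ.+ q) s ⟨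
        ofℤ (p ℤ.+ q ℤ.+ s)    ≡⟨ cong ofℤ p+q+s≡0 ⟩
        0ℚ                     ∎
      product : A * B - norm θ ≡ ofℤ (p ℤ.* q ℤ.- n)
      product = begin
        A * B - norm θ         ≡⟨ cong₂ _-_ (ofℤ-* p q) (sym θ-norm) ⟨
        ofℤ (p ℤ.* q) - ofℤ n  ≡⟨ ofℤ-- (p ℤ.* q) n ⟨
        ofℤ (p ℤ.* q ℤ.- n)    ∎
      re-eq : (w' * (A + u)) * (w * (B + u)) + (w' * (0ℚ + v)) * (w * (0ℚ + v)) * d ≡ 1ℚ
      re-eq = begin
        (w' * (A + u)) * (w * (B + u)) + (w' * (0ℚ + v)) * (w * (0ℚ + v)) * d
          ≡⟨ cayley-hamilton w' w A B u v d ⟩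
        w' * w * ((A * B - (u * u - v * v * d)) + (A + B + (u + u)) * u)
          ≡⟨ cong₂ (λ N S → w' * w * (N + S * u)) product sum≡0 ⟩
        w' * w * (ofℤ (p ℤ.* q ℤ.- n) + 0ℚ * u)
          ≡⟨ cleanup (w' * w) (ofℤ (p ℤ.* q ℤ.- n)) u ⟩
        w' * w * ofℤ (p ℤ.* q ℤ.- n)
          ≡⟨ w'wN≡1 ⟩
        1ℚ ∎
        where
        cayley-hamilton : ∀ w' w A B u v d
          → (w' * (A + u)) * (w * (B + u)) + (w' * (0ℚ + v)) * (w * (0ℚ + v)) * d
          ≡ w' * w * ((A * B - (u * u - v * v * d)) + (A + B + (u + u)) * u)
        cayley-hamilton = solve-∀ ℚ-ring
        cleanup : ∀ W N u → W * (N + 0ℚ * u) ≡ W * N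
        cleanup = solve-∀ ℚ-ring
      im-eq : (w' * (A + u)) * (w * (0ℚ + v)) + (w' * (0ℚ + v)) * (w * (B + u)) ≡ 0ℚ
      im-eq = begin
        (w' * (A + u)) * (w * (0ℚ + v)) + (w' * (0ℚ + v)) * (w * (B + u)) ≡⟨ collect w' w A B u v ⟩
        w' * w * ((A + B + (u + u)) * v)                                  ≡⟨ cong (λ S → w' * w * (S * v)) sum≡0 ⟩
        w' * w * (0ℚ * v)                                                 ≡⟨ vanish (w' * w) v ⟩
        0ℚ                                                                ∎
        where
        collect : ∀ w' w A B u v → (w' * (A + u)) * (w * (0ℚ + v)) + (w' * (0ℚ + v)) * (w * (B + u))
          ≡ w' * w * ((A + B + (u + u)) * v)
        collect = solve-∀ ℚ-ring
        vanish : ∀ W v → W * (0ℚ * v) ≡ 0ℚ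
        vanish = solve-∀ ℚ-ring

    -- (P + θ)/Q has integer part m and ((P + θ)/Q − m)⁻¹ = (P' + θ)/Q': the first two fields say
    -- (P − mQ + θ)(P' + θ) = QQ', and given them, (P + θ)/Q < m + 1 amounts to the bound.
    record Step (P Q m P' Q' : ℤ) : Set where
      field
        trace-eq : P ℤ.+ P' ℤ.+ s ≡ m ℤ.* Q
        norm-eq  : P' ℤ.* P' ℤ.+ s ℤ.* P' ℤ.+ n ≡ ℤ.- (Q ℤ.* Q')
        bound    : Q' ℤ.≤ Q ℤ.+ (P' ℤ.+ P') ℤ.+ s

    module _ {P Q m P' Q'} (step : Step P Q m P' Q') (0≤Q : + 0 ℤ.≤ Q) (0≤Q' : + 0 ℤ.≤ Q')
             {w} (0<w : 0ℚ < w) (wQ≡1 : w * ofℤ Q ≡ 1ℚ) where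
      open Step step

      remainder : P ℤ.- m ℤ.* Q ≡ ℤ.- (P' ℤ.+ s)
      remainder = trans (cong (λ mQ → P ℤ.- mQ) (sym trace-eq)) (cancel P P' s)
        where
        cancel : ∀ P P' s → P ℤ.- (P ℤ.+ P' ℤ.+ s) ≡ ℤ.- (P' ℤ.+ s)
        cancel = solve-∀ ℤ-ring

      excess : (m ℤ.+ + 1) ℤ.* Q ℤ.- P ≡ Q ℤ.+ P' ℤ.+ s
      excess = trans (expand m Q P) (trans (cong (λ mQ → Q ℤ.+ mQ ℤ.- P) (sym trace-eq)) (cancel Q P P' s))
        where
        expand : ∀ m Q P → (m ℤ.+ + 1) ℤ.* Q ℤ.- P ≡ Q ℤ.+ m ℤ.* Q ℤ.- P
        expand = solve-∀ ℤ-ring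
        cancel : ∀ Q P P' s → Q ℤ.+ (P ℤ.+ P' ℤ.+ s) ℤ.- P ≡ Q ℤ.+ P' ℤ.+ s
        cancel = solve-∀ ℤ-ring

      slack : + 0 ℤ.≤ Q ℤ.+ (P' ℤ.+ P') ℤ.+ s ℤ.- Q'
      slack = ℤP.i≤j⇒0≤j-i bound

      lower-norm : let x = P ℤ.- m ℤ.* Q in x ℤ.* x ℤ.+ s ℤ.* x ℤ.+ n ℤ.≤ + 0
      lower-norm = subst (ℤ._≤ + 0) (sym (trans (cong (λ x → x ℤ.* x ℤ.+ s ℤ.* x ℤ.+ n) remainder)
          (trans (reflect P' s n) norm-eq)))
        (ℤP.neg-mono-≤ (ℤP.*-monoʳ-≤-nonNeg Q' {{ℤ.nonNegative 0≤Q'}} 0≤Q))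
        where
        reflect : ∀ P' s n → ℤ.- (P' ℤ.+ s) ℤ.* ℤ.- (P' ℤ.+ s) ℤ.+ s ℤ.* ℤ.- (P' ℤ.+ s) ℤ.+ n
                           ≡ P' ℤ.* P' ℤ.+ s ℤ.* P' ℤ.+ n
        reflect = solve-∀ ℤ-ring

      upper-trace : let y = (m ℤ.+ + 1) ℤ.* Q ℤ.- P in s ℤ.≤ y ℤ.+ y
      upper-trace = ≤-by-slack (ℤP.+-mono-≤ (ℤP.+-mono-≤ slack 0≤Q) 0≤Q')
        (trans (cong (λ y → y ℤ.+ y) excess) (split Q P' s Q'))
        where
        split : ∀ Q P' s Q' → (Q ℤ.+ P' ℤ.+ s) ℤ.+ (Q ℤ.+ P' ℤ.+ s)
                            ≡ s ℤ.+ ((Q ℤ.+ (P' ℤ.+ P') ℤ.+ s ℤ.- Q') ℤ.+ Q ℤ.+ Q')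
        split = solve-∀ ℤ-ring

      upper-norm : let y = (m ℤ.+ + 1) ℤ.* Q ℤ.- P in + 0 ℤ.≤ y ℤ.* y ℤ.- s ℤ.* y ℤ.+ n
      upper-norm = subst (+ 0 ℤ.≤_) (sym factorised) (ℤP.*-monoʳ-≤-nonNeg _ {{ℤ.nonNegative slack}} 0≤Q)
        where
        open ≡-Reasoning
        σ = Q ℤ.+ (P' ℤ.+ P') ℤ.+ s ℤ.- Q'
        split : ∀ Q P' s n Q' → (Q ℤ.+ P' ℤ.+ s) ℤ.* (Q ℤ.+ P' ℤ.+ s) ℤ.- s ℤ.* (Q ℤ.+ P' ℤ.+ s) ℤ.+ n
          ≡ Q ℤ.* (Q ℤ.+ (P' ℤ.+ P') ℤ.+ s ℤ.- Q') ℤ.+ ((P' ℤ.* P' ℤ.+ s ℤ.* P' ℤ.+ n) ℤ.+ Q ℤ.* Q')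
        split = solve-∀ ℤ-ring
        factorised : let y = (m ℤ.+ + 1) ℤ.* Q ℤ.- P in y ℤ.* y ℤ.- s ℤ.* y ℤ.+ n ≡ Q ℤ.* σ
        factorised = begin
          _  ≡⟨ cong (λ y → y ℤ.* y ℤ.- s ℤ.* y ℤ.+ n) excess ⟩
          _  ≡⟨ split Q P' s n Q' ⟩
          Q ℤ.* σ ℤ.+ ((P' ℤ.* P' ℤ.+ s ℤ.* P' ℤ.+ n) ℤ.+ Q ℤ.* Q')
             ≡⟨ cong (λ N → Q ℤ.* σ ℤ.+ (N ℤ.+ Q ℤ.* Q')) norm-eq ⟩
          Q ℤ.* σ ℤ.+ (ℤ.- (Q ℤ.* Q') ℤ.+ Q ℤ.* Q')
             ≡⟨ cong (λ z → Q ℤ.* σ ℤ.+ z) (ℤP.+-inverseˡ (Q ℤ.* Q')) ⟩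
          Q ℤ.* σ ℤ.+ + 0   ≡⟨ ℤP.+-identityʳ (Q ℤ.* σ) ⟩
          Q ℤ.* σ ∎

      quotient-floor : IsFloor D m (quotient P w)
      quotient-floor =
        subst (NonNeg D) (sym (quotient-minus {P} {Q} {m} {w} wQ≡1))
          (nonNeg-scale _ 0<w (nonNeg-plus (P ℤ.- m ℤ.* Q) lower-norm)) ,
        subst (NonNeg D) (sym (minus-quotient {P} {Q} {m ℤ.+ + 1} {w} wQ≡1))
          (nonNeg-scale _ 0<w (nonNeg-minus ((m ℤ.+ + 1) ℤ.* Q ℤ.- P) upper-trace upper-norm)) ,
        λ X≡m+1 → ℚP.<-irrefl (sym (cong im X≡m+1))
                    (*-pos 0<w (subst (0ℚ <_) (sym (ℚP.+-identityˡ (im θ))) 0<imθ))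

      quotient-step : ∀ {w'} → w' * ofℤ Q' ≡ 1ℚ → mul D (quotient P' w') (quotient P w ⊖ embℤ m) ≡ oneQ
      quotient-step {w'} w'Q'≡1 =
        trans (cong (mul D (quotient P' w')) (quotient-minus {P} {Q} {m} {w} wQ≡1))
        (mul-quotients {P'} {P ℤ.- m ℤ.* Q} {w'} {w} sum≡0 product≡1)
        where
        open ≡-Reasoning
        sum≡0 : P' ℤ.+ (P ℤ.- m ℤ.* Q) ℤ.+ s ≡ + 0
        sum≡0 = trans (cong (λ x → P' ℤ.+ x ℤ.+ s) remainder) (cancel P' s)
          where
          cancel : ∀ P' s → P' ℤ.+ ℤ.- (P' ℤ.+ s) ℤ.+ s ≡ + 0
          cancel = solve-∀ ℤ-ring
        norm-product : P' ℤ.* (P ℤ.- m ℤ.* Q) ℤ.- n ≡ Q' ℤ.* Q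
        norm-product = begin
          P' ℤ.* (P ℤ.- m ℤ.* Q) ℤ.- n             ≡⟨ cong (λ x → P' ℤ.* x ℤ.- n) remainder ⟩
          P' ℤ.* ℤ.- (P' ℤ.+ s) ℤ.- n             ≡⟨ negate P' s n ⟩
          ℤ.- (P' ℤ.* P' ℤ.+ s ℤ.* P' ℤ.+ n)      ≡⟨ cong ℤ.-_ norm-eq ⟩
          ℤ.- ℤ.- (Q ℤ.* Q')                      ≡⟨ ℤP.neg-involutive (Q ℤ.* Q') ⟩
          Q ℤ.* Q'                                ≡⟨ ℤP.*-comm Q Q' ⟩
          Q' ℤ.* Q                                ∎
          where
          negate : ∀ P' s n → P' ℤ.* ℤ.- (P' ℤ.+ s) ℤ.- n ≡ ℤ.- (P' ℤ.* P' ℤ.+ s ℤ.* P' ℤ.+ n)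
          negate = solve-∀ ℤ-ring
        product≡1 : w' * w * ofℤ (P' ℤ.* (P ℤ.- m ℤ.* Q) ℤ.- n) ≡ 1ℚ
        product≡1 = begin
          w' * w * ofℤ (P' ℤ.* (P ℤ.- m ℤ.* Q) ℤ.- n)   ≡⟨ cong (λ z → w' * w * ofℤ z) norm-product ⟩
          w' * w * ofℤ (Q' ℤ.* Q)                        ≡⟨ cong (λ z → w' * w * z) (ofℤ-* Q' Q) ⟩
          w' * w * (ofℤ Q' * ofℤ Q)                      ≡⟨ pair-up w' w (ofℤ Q') (ofℤ Q) ⟩
          (w' * ofℤ Q') * (w * ofℤ Q)                    ≡⟨ cong₂ _*_ w'Q'≡1 wQ≡1 ⟩
          1ℚ * 1ℚ                                        ≡⟨ ℚP.*-identityˡ 1ℚ ⟩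
          1ℚ                                             ∎
          where
          pair-up : ∀ w' w a b → w' * w * (a * b) ≡ (w' * a) * (w * b)
          pair-up = solve-∀ ℚ-ring

-- The continued fraction of ε + ε²

module _ (D : ℕ) where
  open QuadraticField D

  module UnitExpansion (a b : ℚ) (k : ℕ) (trace : a + a ≡ ofℤ (+ 5 ℤ.+ + k))
         (norm≡1 : norm (a +√ b) ≡ 1ℚ) (0<b : 0ℚ < b) where

    t h s n : ℤ
    t = + 5 ℤ.+ + k
    h = t ℤ.+ 1ℤ
    s = h ℤ.* t
    n = h ℤ.* h

    ε θ : Q√
    ε = a +√ b
    θ = scale (ofℤ h) ε

    ofℤ-h : ofℤ h ≡ a + a + 1ℚ
    ofℤ-h = trans (ofℤ-+ t 1ℤ) (cong (_+ 1ℚ) (sym trace))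

    θ-trace : re θ + re θ ≡ ofℤ s
    θ-trace = begin
      ofℤ h * a + ofℤ h * a   ≡⟨ ℚP.*-distribˡ-+ (ofℤ h) a a ⟨
      ofℤ h * (a + a)         ≡⟨ cong (ofℤ h *_) trace ⟩
      ofℤ h * ofℤ t           ≡⟨ ofℤ-* h t ⟨
      ofℤ s                   ∎
      where open ≡-Reasoning

    θ-norm : norm θ ≡ ofℤ n
    θ-norm = begin
      (H * a) * (H * a) - (H * b) * (H * b) * d   ≡⟨ factor H a b d ⟩
      (H * H) * (a * a - b * b * d)               ≡⟨ cong (H * H *_) norm≡1 ⟩
      (H * H) * 1ℚ                                ≡⟨ ℚP.*-identityʳ (H * H) ⟩
      H * H                                       ≡⟨ ofℤ-* h h ⟨
      ofℤ n                                       ∎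
      where
      open ≡-Reasoning
      H = ofℤ h
      factor : ∀ H a b d → (H * a) * (H * a) - (H * b) * (H * b) * d ≡ (H * H) * (a * a - b * b * d)
      factor = solve-∀ ℚ-ring

    0<imθ : 0ℚ < im θ
    0<imθ = *-pos (ℚP.<-≤-trans (ℚP.positive⁻¹ 1ℚ) (ofℤ-mono-≤ {1ℤ} {h} (ℤ.+≤+ (ℕ.s≤s ℕ.z≤n)))) 0<b

    open CompleteQuotients D θ s n θ-trace θ-norm 0<imθ

    P Q A : ℕ → ℤ
    P 0 = ℤ.- 1ℤ
    P 1 = ℤ.- + 2
    P 2 = ℤ.- (t ℤ.+ + 3)
    P 3 = ℤ.- (t ℤ.+ + 3)
    P 4 = ℤ.- + 2
    P (suc (suc (suc (suc (suc j))))) = P (suc j)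

    Q 0 = 1ℤ
    Q 1 = t ℤ.* t ℤ.- + 5
    Q 2 = t ℤ.+ + 2
    Q 3 = t ℤ.* t ℤ.- + 5
    Q 4 = 1ℤ
    Q (suc (suc (suc (suc (suc j))))) = Q (suc j)

    A 0 = t ℤ.* t ℤ.+ t ℤ.- + 3
    A 1 = 1ℤ
    A 2 = t ℤ.- + 3
    A 3 = 1ℤ
    A 4 = t ℤ.* t ℤ.+ t ℤ.- + 4
    A (suc (suc (suc (suc (suc j))))) = A (suc j)

    Q-pos : ∀ j → 1ℤ ℤ.≤ Q j
    Q-pos 0 = ℤP.≤-refl
    Q-pos 1 = ≤-by-horner (19 ∷ 10 ∷ 1 ∷ []) k (t²-5 (+ k))
      where
      t²-5 : ∀ κ → let t = + 5 ℤ.+ κ in t ℤ.* t ℤ.- + 5 ≡ 1ℤ ℤ.+ (+ 19 ℤ.+ κ ℤ.* (+ 10 ℤ.+ κ ℤ.* + 1))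
      t²-5 = solve-∀ ℤ-ring
    Q-pos 2 = ℤ.+≤+ (ℕ.s≤s ℕ.z≤n)
    Q-pos 3 = Q-pos 1
    Q-pos 4 = ℤP.≤-refl
    Q-pos (suc (suc (suc (suc (suc j))))) = Q-pos (suc j)

    private
      norm₀₄ : ∀ t → ℤ.- + 2 ℤ.* ℤ.- + 2 ℤ.+ (t ℤ.+ 1ℤ) ℤ.* t ℤ.* ℤ.- + 2 ℤ.+ (t ℤ.+ 1ℤ) ℤ.* (t ℤ.+ 1ℤ)
                    ≡ ℤ.- (1ℤ ℤ.* (t ℤ.* t ℤ.- + 5))
      norm₀₄ = solve-∀ ℤ-ring
      bound₀₄ : ∀ κ → let t = + 5 ℤ.+ κ in
        1ℤ ℤ.+ (ℤ.- + 2 ℤ.+ ℤ.- + 2) ℤ.+ (t ℤ.+ 1ℤ) ℤ.* t ≡ (t ℤ.* t ℤ.- + 5) ℤ.+ (+ 7 ℤ.+ κ ℤ.* + 1)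
      bound₀₄ = solve-∀ ℤ-ring

    transition : ∀ j → Step (P j) (Q j) (A j) (P (suc j)) (Q (suc j))
    transition 0 = record
      { trace-eq = trace₀ t ; norm-eq = norm₀₄ t ; bound = ≤-by-horner (7 ∷ 1 ∷ []) k (bound₀₄ (+ k)) }
      where
      trace₀ : ∀ t → ℤ.- 1ℤ ℤ.+ ℤ.- + 2 ℤ.+ (t ℤ.+ 1ℤ) ℤ.* t ≡ (t ℤ.* t ℤ.+ t ℤ.- + 3) ℤ.* 1ℤ
      trace₀ = solve-∀ ℤ-ring
    transition 1 = record
      { trace-eq = trace₁ t ; norm-eq = norm₁ t ; bound = ≤-by-horner (27 ∷ 18 ∷ 2 ∷ []) k (bound₁ (+ k)) }
      where
      trace₁ : ∀ t → ℤ.- + 2 ℤ.+ ℤ.- (t ℤ.+ + 3) ℤ.+ (t ℤ.+ 1ℤ) ℤ.* t ≡ 1ℤ ℤ.* (t ℤ.* t ℤ.- + 5)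
      trace₁ = solve-∀ ℤ-ring
      norm₁ : ∀ t → let P' = ℤ.- (t ℤ.+ + 3) in
        P' ℤ.* P' ℤ.+ (t ℤ.+ 1ℤ) ℤ.* t ℤ.* P' ℤ.+ (t ℤ.+ 1ℤ) ℤ.* (t ℤ.+ 1ℤ) ≡ ℤ.- ((t ℤ.* t ℤ.- + 5) ℤ.* (t ℤ.+ + 2))
      norm₁ = solve-∀ ℤ-ring
      bound₁ : ∀ κ → let t = + 5 ℤ.+ κ in
        (t ℤ.* t ℤ.- + 5) ℤ.+ (ℤ.- (t ℤ.+ + 3) ℤ.+ ℤ.- (t ℤ.+ + 3)) ℤ.+ (t ℤ.+ 1ℤ) ℤ.* t
        ≡ (t ℤ.+ + 2) ℤ.+ (+ 27 ℤ.+ κ ℤ.* (+ 18 ℤ.+ κ ℤ.* + 2))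
      bound₁ = solve-∀ ℤ-ring
    transition 2 = record
      { trace-eq = trace₂ t ; norm-eq = norm₂ t ; bound = ≤-by-horner (1 ∷ []) k (bound₂ t) }
      where
      trace₂ : ∀ t → ℤ.- (t ℤ.+ + 3) ℤ.+ ℤ.- (t ℤ.+ + 3) ℤ.+ (t ℤ.+ 1ℤ) ℤ.* t ≡ (t ℤ.- + 3) ℤ.* (t ℤ.+ + 2)
      trace₂ = solve-∀ ℤ-ring
      norm₂ : ∀ t → let P' = ℤ.- (t ℤ.+ + 3) in
        P' ℤ.* P' ℤ.+ (t ℤ.+ 1ℤ) ℤ.* t ℤ.* P' ℤ.+ (t ℤ.+ 1ℤ) ℤ.* (t ℤ.+ 1ℤ) ≡ ℤ.- ((t ℤ.+ + 2) ℤ.* (t ℤ.* t ℤ.- + 5))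
      norm₂ = solve-∀ ℤ-ring
      bound₂ : ∀ t → (t ℤ.+ + 2) ℤ.+ (ℤ.- (t ℤ.+ + 3) ℤ.+ ℤ.- (t ℤ.+ + 3)) ℤ.+ (t ℤ.+ 1ℤ) ℤ.* t
                   ≡ (t ℤ.* t ℤ.- + 5) ℤ.+ + 1
      bound₂ = solve-∀ ℤ-ring
    transition 3 = record
      { trace-eq = trace₃ t ; norm-eq = norm₃ t ; bound = ≤-by-horner (45 ∷ 21 ∷ 2 ∷ []) k (bound₃ (+ k)) }
      where
      trace₃ : ∀ t → ℤ.- (t ℤ.+ + 3) ℤ.+ ℤ.- + 2 ℤ.+ (t ℤ.+ 1ℤ) ℤ.* t ≡ 1ℤ ℤ.* (t ℤ.* t ℤ.- + 5)
      trace₃ = solve-∀ ℤ-ring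
      norm₃ : ∀ t → ℤ.- + 2 ℤ.* ℤ.- + 2 ℤ.+ (t ℤ.+ 1ℤ) ℤ.* t ℤ.* ℤ.- + 2 ℤ.+ (t ℤ.+ 1ℤ) ℤ.* (t ℤ.+ 1ℤ)
                   ≡ ℤ.- ((t ℤ.* t ℤ.- + 5) ℤ.* 1ℤ)
      norm₃ = solve-∀ ℤ-ring
      bound₃ : ∀ κ → let t = + 5 ℤ.+ κ in
        (t ℤ.* t ℤ.- + 5) ℤ.+ (ℤ.- + 2 ℤ.+ ℤ.- + 2) ℤ.+ (t ℤ.+ 1ℤ) ℤ.* t
        ≡ 1ℤ ℤ.+ (+ 45 ℤ.+ κ ℤ.* (+ 21 ℤ.+ κ ℤ.* + 2))
      bound₃ = solve-∀ ℤ-ring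
    transition 4 = record
      { trace-eq = trace₄ t ; norm-eq = norm₀₄ t ; bound = ≤-by-horner (7 ∷ 1 ∷ []) k (bound₀₄ (+ k)) }
      where
      trace₄ : ∀ t → ℤ.- + 2 ℤ.+ ℤ.- + 2 ℤ.+ (t ℤ.+ 1ℤ) ℤ.* t ≡ (t ℤ.* t ℤ.+ t ℤ.- + 4) ℤ.* 1ℤ
      trace₄ = solve-∀ ℤ-ring
    transition (suc (suc (suc (suc (suc j))))) = transition (suc j)

    private
      0<ofℤQ : ∀ j → 0ℚ < ofℤ (Q j)
      0<ofℤQ j = ℚP.<-≤-trans (ℚP.positive⁻¹ 1ℚ) (ofℤ-mono-≤ (Q-pos j))

      ofℤQ-nonZero : ∀ j → ℚ.NonZero (ofℤ (Q j))
      ofℤQ-nonZero j = ℚ.>-nonZero (0<ofℤQ j)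

    weight : ℕ → ℚ
    weight j = ℚ.1/_ (ofℤ (Q j)) {{ofℤQ-nonZero j}}

    weight-pos : ∀ j → 0ℚ < weight j
    weight-pos j = ℚP.positive⁻¹ (weight j) {{ℚP.1/pos⇒pos (ofℤ (Q j)) {{ℚ.positive (0<ofℤQ j)}}}}

    weight-inverse : ∀ j → weight j * ofℤ (Q j) ≡ 1ℚ
    weight-inverse j = ℚP.*-inverseˡ (ofℤ (Q j)) {{ofℤQ-nonZero j}}

    Q-nonNeg : ∀ j → + 0 ℤ.≤ Q j
    Q-nonNeg j = ℤP.≤-trans (ℤ.+≤+ ℕ.z≤n) (Q-pos j)

    X : ℕ → Q√
    X j = quotient (P j) (weight j)

    X₀ : X 0 ≡ ε ⊕ mul D ε ε
    X₀ = cong₂ _+√_ re-eq im-eq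
      where
      open ≡-Reasoning
      weight₀ : weight 0 ≡ 1ℚ
      weight₀ = trans (sym (ℚP.*-identityʳ (weight 0))) (weight-inverse 0)
      re-eq : weight 0 * (ofℤ (ℤ.- 1ℤ) + ofℤ h * a) ≡ a + (a * a + b * b * d)
      re-eq = begin
        weight 0 * (ofℤ (ℤ.- 1ℤ) + ofℤ h * a)               ≡⟨ cong₂ (λ w H → w * (ofℤ (ℤ.- 1ℤ) + H * a)) weight₀ ofℤ-h ⟩
        1ℚ * (ofℤ (ℤ.- 1ℤ) + (a + a + 1ℚ) * a)              ≡⟨ expand a b d ⟩
        a + (a * a + b * b * d) + (norm ε - 1ℚ)             ≡⟨ cong (λ N → a + (a * a + b * b * d) + (N - 1ℚ)) norm≡1 ⟩
        a + (a * a + b * b * d) + (1ℚ - 1ℚ)                 ≡⟨ cleanup (a + (a * a + b * b * d)) ⟩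
        a + (a * a + b * b * d)                             ∎
        where
        expand : ∀ a b d → 1ℚ * (ofℤ (ℤ.- 1ℤ) + (a + a + 1ℚ) * a) ≡ a + (a * a + b * b * d) + ((a * a - b * b * d) - 1ℚ)
        expand = solve-∀ ℚ-ring
        cleanup : ∀ x → x + (1ℚ - 1ℚ) ≡ x
        cleanup = solve-∀ ℚ-ring
      im-eq : weight 0 * (0ℚ + ofℤ h * b) ≡ b + (a * b + b * a)
      im-eq = begin
        weight 0 * (0ℚ + ofℤ h * b)                         ≡⟨ cong₂ (λ w H → w * (0ℚ + H * b)) weight₀ ofℤ-h ⟩
        1ℚ * (0ℚ + (a + a + 1ℚ) * b)                        ≡⟨ expand a b ⟩
        b + (a * b + b * a)                                 ∎
        where
        expand : ∀ a b → 1ℚ * (0ℚ + (a + a + 1ℚ) * b) ≡ b + (a * b + b * a)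
        expand = solve-∀ ℚ-ring

    expansion : CFExpansion D (ε ⊕ mul D ε ε)
    expansion = record
      { xs    = X
      ; as    = A
      ; start = X₀
      ; floor = λ j → quotient-floor (transition j) (Q-nonNeg j) (Q-nonNeg (suc j)) (weight-pos j) (weight-inverse j)
      ; step  = λ j → quotient-step (transition j) (Q-nonNeg j) (Q-nonNeg (suc j)) (weight-pos j) (weight-inverse j)
                        {weight (suc j)} (weight-inverse (suc j))
      }

    A-periodic : EventuallyPeriodic A 4
    A-periodic = 1 , λ { zero () ; (suc j) _ → cong A (ℕP.+-comm (suc j) 4) }

    A-cycle : ∀ i j → A (i ℕ.* 4 ℕ.+ suc j) ≡ A (suc j)
    A-cycle zero    j = refl
    A-cycle (suc i) j = trans (cong (λ r → A (4 ℕ.+ r)) (ℕP.+-suc (i ℕ.* 4) j))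
                              (trans (cong A (sym (ℕP.+-suc (i ℕ.* 4) j))) (A-cycle i j))

    periodic-from-1 : ∀ {q} → EventuallyPeriodic A q → ∀ r → A (suc (r ℕ.+ q)) ≡ A (suc r)
    periodic-from-1 {q} (k₀ , periodic) r = begin
      A (suc (r ℕ.+ q))                ≡⟨ A-cycle k₀ (r ℕ.+ q) ⟨
      A (k₀ ℕ.* 4 ℕ.+ suc (r ℕ.+ q))   ≡⟨ cong A (ℕP.+-assoc (k₀ ℕ.* 4) (suc r) q) ⟨
      A (k₀ ℕ.* 4 ℕ.+ suc r ℕ.+ q)     ≡⟨ periodic (k₀ ℕ.* 4 ℕ.+ suc r) (ℕP.≤-trans (ℕP.m≤m*n k₀ 4) (ℕP.m≤m+n _ _)) ⟩
      A (k₀ ℕ.* 4 ℕ.+ suc r)           ≡⟨ A-cycle k₀ r ⟩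
      A (suc r)                        ∎
      where open ≡-Reasoning

    A₁<A₂ : A 1 ℤ.< A 2
    A₁<A₂ = ℤP.suc[i]≤j⇒i<j (≤-by-horner (0 ∷ 1 ∷ []) k (gap (+ k)))
      where
      gap : ∀ κ → let t = + 5 ℤ.+ κ in t ℤ.- + 3 ≡ (1ℤ ℤ.+ 1ℤ) ℤ.+ (+ 0 ℤ.+ κ ℤ.* + 1)
      gap = solve-∀ ℤ-ring

    A₂<A₄ : A 2 ℤ.< A 4
    A₂<A₄ = ℤP.suc[i]≤j⇒i<j (≤-by-horner (23 ∷ 10 ∷ 1 ∷ []) k (gap (+ k)))
      where
      gap : ∀ κ → let t = + 5 ℤ.+ κ in t ℤ.* t ℤ.+ t ℤ.- + 4 ≡ (1ℤ ℤ.+ (t ℤ.- + 3)) ℤ.+ (+ 23 ℤ.+ κ ℤ.* (+ 10 ℤ.+ κ ℤ.* + 1))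
      gap = solve-∀ ℤ-ring

    A-least-period : ∀ q → 0 ℕ.< q → EventuallyPeriodic A q → 4 ℕ.≤ q
    A-least-period 1 _ periodic = ⊥-elim (ℤP.<⇒≢ A₁<A₂ (sym (periodic-from-1 periodic 0)))
    A-least-period 2 _ periodic = ⊥-elim (ℤP.<⇒≢ A₂<A₄ (sym (periodic-from-1 periodic 1)))
    A-least-period 3 _ periodic = ⊥-elim (ℤP.<⇒≢ (ℤP.<-trans A₁<A₂ A₂<A₄) (sym (periodic-from-1 periodic 0)))
    A-least-period (suc (suc (suc (suc q)))) _ _ = ℕ.s≤s (ℕ.s≤s (ℕ.s≤s (ℕ.s≤s ℕ.z≤n)))

    periodLength : PeriodLength D (ε ⊕ mul D ε ε) 4
    periodLength = expansion , ℕ.s≤s ℕ.z≤n , A-periodic , A-least-period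

5≤x⇒x≡5+k : ∀ {x} → + 5 ℤ.≤ x → ∃[ k ] x ≡ + 5 ℤ.+ + k
5≤x⇒x≡5+k (ℤ.+≤+ {n = n} 5≤n) = n ℕ.∸ 5 , cong +_ (sym (ℕP.m+[n∸m]≡n 5≤n))

module UnitSquare {D : ℕ} (nonSquare : NonSquare D) {α : Q√} (imα≢0 : im α ≢ 0ℚ) (α>1 : LtQ D oneQ α)
                  (T c : ℤ) (trace-α : re α + re α ≡ ofℤ T) (norm-α : QuadraticField.norm D α ≡ ofℤ c)
                  (c≡±1 : c ≡ 1ℤ ⊎ c ≡ -1ℤ) where
  open QuadraticField D
  open UnitAboveOne D nonSquare {re α} {im α} T c imα≢0 trace-α norm-α c≡±1 using (unit>1-bounds)

  a b : ℚ
  a = re α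
  b = im α

  β : Q√
  β = mul D α α

  τ : ℤ
  τ = T ℤ.* T ℤ.- + 2 ℤ.* c

  trace-β : re β + re β ≡ ofℤ τ
  trace-β = begin
    (a * a + b * b * d) + (a * a + b * b * d)           ≡⟨ regroup a b d ⟩
    (a + a) * (a + a) - ofℤ (+ 2) * (a * a - b * b * d) ≡⟨ cong₂ (λ T c → T * T - ofℤ (+ 2) * c) trace-α norm-α ⟩
    ofℤ T * ofℤ T - ofℤ (+ 2) * ofℤ c                   ≡⟨ cong₂ _-_ (ofℤ-* T T) (ofℤ-* (+ 2) c) ⟨
    ofℤ (T ℤ.* T) - ofℤ (+ 2 ℤ.* c)                     ≡⟨ ofℤ-- (T ℤ.* T) (+ 2 ℤ.* c) ⟨
    ofℤ τ                                               ∎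
    where
    open ≡-Reasoning
    regroup : ∀ a b d → (a * a + b * b * d) + (a * a + b * b * d)
                      ≡ (a + a) * (a + a) - ofℤ (+ 2) * (a * a - b * b * d)
    regroup = solve-∀ ℚ-ring

  norm-β : norm β ≡ 1ℚ
  norm-β = begin
    norm β               ≡⟨ norm-mul α α ⟩
    norm α * norm α      ≡⟨ cong₂ _*_ norm-α norm-α ⟩
    ofℤ c * ofℤ c        ≡⟨ ofℤ-* c c ⟨
    ofℤ (c ℤ.* c)        ≡⟨ cong ofℤ (≡±1⇒square≡1 c≡±1) ⟩
    1ℚ                   ∎
    where open ≡-Reasoning

  0<a : 0ℚ < a
  0<a = proj₁ (unit>1-bounds α>1)

  0<b : 0ℚ < b
  0<b = proj₁ (proj₂ (unit>1-bounds α>1))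

  3≤τ : + 3 ℤ.≤ τ
  3≤τ = proj₂ (proj₂ (unit>1-bounds α>1))

  0<re-β : 0ℚ < re β
  0<re-β = ℚP.+-mono-<-≤ (*-pos 0<a 0<a) (*-nonNeg (*-nonNeg (ℚP.<⇒≤ 0<b) (ℚP.<⇒≤ 0<b)) 0≤d)

  0<im-β : 0ℚ < im β
  0<im-β = ℚP.+-mono-< (*-pos 0<a 0<b) (*-pos 0<b 0<a)

  open NormOnePowers D (re β) (im β) τ trace-β norm-β using (trace-pow; norm-pow; im-pow-pos)

  even-power-period : ∀ m → 3 ℕ.≤ m
    → PeriodLength D (pow D α (m ℕ.* 2) ⊕ mul D (pow D α (m ℕ.* 2)) (pow D α (m ℕ.* 2))) 4
  even-power-period (suc m) 3≤m =
    subst (λ ε → PeriodLength D (ε ⊕ mul D ε ε) 4) (sym (pow-*2 α (suc m)))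
      (UnitExpansion.periodLength D (re ε) (im ε) k trace-ε (norm-pow (suc m)) (im-pow-pos 0<re-β 0<im-β m))
    where
    ε = pow D β (suc m)
    large-trace = 5≤x⇒x≡5+k (ℤP.≤-trans (ℤ.+≤+ (ℕ.s≤s (ℕ.s≤s 3≤m))) (lucas-growth 3≤τ (suc m)))
    k = proj₁ large-trace
    trace-ε : re ε + re ε ≡ ofℤ (+ 5 ℤ.+ + k)
    trace-ε = trans (trace-pow (suc m)) (cong ofℤ (proj₂ large-trace))

proposition6p2 : (D : ℕ) → NonSquare D → (α : Q√) → im α ≢ 0ℚ
    → IsUnitOfIntegers D α → LtQ D oneQ α
    → (r : ℕ → ℕ) → (∀ n → 2 ∣ r n) → (∀ n → 0 ℕ.< r n) → TendsToInfinity r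
    → ∃[ N ] (∀ n → N ℕ.≤ n
        → PeriodLength D (pow D α (r n) ⊕ pow D α (2 ℕ.* r n)) 4)
proposition6p2 D nonSquare α imα≢0 unit α>1 r r-even _ r→∞ = N , period-four
  where
  open QuadraticField D
  N = proj₁ (r→∞ 6)

  even-power-period : ∀ m → 3 ℕ.≤ m
    → PeriodLength D (pow D α (m ℕ.* 2) ⊕ mul D (pow D α (m ℕ.* 2)) (pow D α (m ℕ.* 2))) 4
  even-power-period =
    let T , c , trace-α , norm-α , c≡±1 = unit-trace-norm D α imα≢0 unit
    in UnitSquare.even-power-period nonSquare imα≢0 α>1 T c trace-α norm-α c≡±1

  period-four : ∀ n → N ℕ.≤ n → PeriodLength D (pow D α (r n) ⊕ pow D α (2 ℕ.* r n)) 4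
  period-four n N≤n = halve (r-even n) (proj₂ (r→∞ 6) n N≤n)
    where
    halve : 2 ∣ r n → 6 ℕ.≤ r n → PeriodLength D (pow D α (r n) ⊕ pow D α (2 ℕ.* r n)) 4
    halve (divides m r≡m*2) 6≤r =
      subst (λ A → PeriodLength D A 4)
        (sym (trans (cong (pow D α (r n) ⊕_) (pow-double α (r n)))
                    (cong (λ e → pow D α e ⊕ mul D (pow D α e) (pow D α e)) r≡m*2)))
        (even-power-period m (ℕP.*-cancelʳ-≤ 3 m 2 (subst (6 ℕ.≤_) r≡m*2 6≤r)))
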